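{- Let $G$ be a graph. (i) $G$ is $2$-$\gamma_{\rm SMB}$-critical if and only if $G$ is isomorphic to $G_n'\cup K_1$ for some $n\ge 1$, or to $G_n''$ for some $n\ge 2$. (ii) $G$ is $2$-$\gamma_{\rm SMB}'$-critical if and only if $G$ is isomorphic to $G_n'$ for some $n\ge 1$.
   Context: Graphs are finite and simple; $\cup$ denotes disjoint union. $G_n'$ is the graph obtained from the complete graph $K_n$ by attaching exactly two pendant vertices (new leaves) to one vertex of $K_n$; $G_n''$ ($n\ge 2$) is obtained from $K_n$ by attaching exactly two pendant vertices to each of two different vertices of $K_n$. The Maker-Breaker domination (MBD) game on a graph $G$ is played by Dominator and Staller, who alternately select previously unselected vertices of $G$. Dominator wins if the set of vertices he has selected becomes a dominating set of $G$; Staller wins if she has selected at least one vertex of every dominating set of $G$ (equivalently, all vertices of some closed neighbourhood $N[v]$). In the D-game Dominator moves first, in the S-game Staller moves first. $\gamma_{\rm SMB}(G)$ (resp. $\gamma_{\rm SMB}'(G)$) is the minimum number $k$ such that Staller has a strategy in the D-game (resp. S-game) guaranteeing that she wins having made at most $k$ moves, whatever Dominator does; it is $\infty$ if Staller has no winning strategy. For $\tau\in\{\gamma_{\rm SMB},\gamma_{\rm SMB}'\}$, $G$ is $k$-$\tau$-critical if $\tau(G)=k$ and $\tau(G)<\tau(G+e)$ for every pair $e$ of nonadjacent distinct vertices of $G$. -}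

module Defs where

open import Data.Nat using (ℕ; zero; suc; _+_; _<_; _≤_)
import Data.Nat as ℕ
open import Data.Bool using (Bool; true; false; _∧_; _∨_; not)
open import Data.Fin using (Fin; toℕ)
import Data.Fin as F
open import Data.Fin.Subset using (Subset; _∈_; _∉_; _⊆_; _∪_; ⁅_⁆; ⊥)
open import Data.Vec using (tabulate)
open import Data.Product using (Σ; ∃; _×_; _,_)
open import Data.Sum using (_⊎_)
open import Data.Empty renaming (⊥ to Empty)
open import Relation.Nullary using (¬_)
open import Relation.Nullary.Decidable using (⌊_⌋)
open import Relation.Binary.PropositionalEquality using (_≡_; _≢_)
open import Function.Bundles using (_↔_; Inverse)

Graph : ℕ → Set
Graph m = Fin m → Fin m → Bool

record IsSimple {m : ℕ} (G : Graph m) : Set where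
  field
    symmetric  : ∀ x y → G x y ≡ G y x
    irreflexive : ∀ x → G x x ≡ false

addEdge : ∀ {m} → Graph m → Fin m → Fin m → Graph m
addEdge G x y i j =
  G i j ∨ (⌊ i F.≟ x ⌋ ∧ ⌊ j F.≟ y ⌋) ∨ (⌊ i F.≟ y ⌋ ∧ ⌊ j F.≟ x ⌋)

record _≅_ {m k : ℕ} (G : Graph m) (H : Graph k) : Set where
  field
    bij      : Fin m ↔ Fin k
    preserve : ∀ x y → G x y ≡ H (Inverse.to bij x) (Inverse.to bij y)

module Game {m : ℕ} (G : Graph m) where

  N[_] : Fin m → Subset m
  N[ v ] = tabulate (λ u → ⌊ u F.≟ v ⌋ ∨ G v u)

  Dominating : Subset m → Set
  Dominating D = ∀ u → ∃ λ v → v ∈ D × (v ≡ u ⊎ G v u ≡ true)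

  StallerWon : Subset m → Set
  StallerWon S = ∃ λ u → N[ u ] ⊆ S

  -- DTurn k D S : it is Dominator's turn, Dominator has claimed D,
  -- Staller has claimed S, and Staller can force a win making at most
  -- k further moves.
  -- STurn k D S : same, but it is Staller's turn.
  DTurn : ℕ → Subset m → Subset m → Set
  STurn : ℕ → Subset m → Subset m → Set

  DTurn k D S =
    ¬ Dominating D ×
    (∀ v → v ∉ D → v ∉ S →
       ¬ Dominating (D ∪ ⁅ v ⁆) × STurn k (D ∪ ⁅ v ⁆) S)

  STurn zero D S = Empty
  STurn (suc k) D S =
    ∃ λ v → v ∉ D × v ∉ S ×
      (StallerWon (S ∪ ⁅ v ⁆) ⊎ DTurn k D (S ∪ ⁅ v ⁆))

StallerWinsD : ∀ {m} → Graph m → ℕ → Set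
StallerWinsD G k = Game.DTurn G k ⊥ ⊥

StallerWinsS : ∀ {m} → Graph m → ℕ → Set
StallerWinsS G k = Game.STurn G k ⊥ ⊥

-- τ(G) = k for the invariant determined by the win predicate W
-- (τ(G) is the least k such that W G k; ∞ if none)
ValueIs : (∀ {m} → Graph m → ℕ → Set) → ∀ {m} → Graph m → ℕ → Set
ValueIs W G k = W G k × (∀ j → j < k → ¬ W G j)

Critical : (∀ {m} → Graph m → ℕ → Set) → ℕ → ∀ {m} → Graph m → Set
Critical W k G =
  ValueIs W G k ×
  (∀ x y → x ≢ y → G x y ≡ false → ∀ j → j ≤ k → ¬ W (addEdge G x y) j)

private
  _==_ : ℕ → ℕ → Bool
  a == b = ⌊ a ℕ.≟ b ⌋
  _<ᵇ_ : ℕ → ℕ → Bool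
  a <ᵇ b = ⌊ a ℕ.<? b ⌋

  cliqueEdge : ℕ → ℕ → ℕ → Bool
  cliqueEdge n i j = (i <ᵇ n) ∧ (j <ᵇ n) ∧ not (i == j)

  leafEdge : ℕ → ℕ → ℕ → ℕ → Bool
  leafEdge c l i j = (i == c ∧ j == l) ∨ (i == l ∧ j == c)

-- G_n' ∪ K_1 on n+3 vertices: clique {0..n-1}, leaves n, n+1 attached
-- to vertex 0, isolated vertex n+2.
Gn'∪K1 : (n : ℕ) → Graph (n + 3)
Gn'∪K1 n x y =
  cliqueEdge n i j ∨ leafEdge 0 n i j ∨ leafEdge 0 (suc n) i j
  where i = toℕ x ; j = toℕ y

-- G_n' on n+2 vertices: clique {0..n-1}, leaves n, n+1 attached to 0.
Gn' : (n : ℕ) → Graph (n + 2)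
Gn' n x y =
  cliqueEdge n i j ∨ leafEdge 0 n i j ∨ leafEdge 0 (suc n) i j
  where i = toℕ x ; j = toℕ y

-- G_n'' on n+4 vertices: clique {0..n-1}, leaves n, n+1 attached to 0,
-- leaves n+2, n+3 attached to 1.
Gn'' : (n : ℕ) → Graph (n + 4)
Gn'' n x y =
  cliqueEdge n i j ∨ leafEdge 0 n i j ∨ leafEdge 0 (suc n) i j
    ∨ leafEdge 1 (n + 2) i j ∨ leafEdge 1 (n + 3) i j
  where i = toℕ x ; j = toℕ y

{-# OPTIONS --safe #-}

-- Staller wins within two moves exactly when she has a threat: in the S-game an isolated vertex
-- or two leaves hanging on a common support; in the D-game, for every first move d of Dominator,
-- such a threat avoiding d.  She wins within one move iff G has an isolated vertex (S-game), resp.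
-- two of them (D-game).  So if G is 2-critical, adding a non-edge away from the threat vertices
-- would keep a threat; hence all such pairs are edges and G is a clique carrying the threat
-- vertices: G'_n in the S-game, G'_n ∪ K_1 or G''_n in the D-game.  Conversely, in these graphs
-- a new edge gives a leaf a second neighbour or joins the isolated vertex, and then no threat
-- survives (in the D-game: none avoiding a well-chosen first move of Dominator).  A graph of one
-- of these shapes is identified with the canonical one by a permutation matching the
-- distinguished vertices.

module Submission where

open import Defs
open import Data.Nat using (ℕ; _≤_)
open import Data.Product using (Σ; _×_)
open import Data.Sum using (_⊎_)
open import Function.Bundles using (_⇔_)

open import Data.Bool as Bool using (Bool; true; false; _∧_; _∨_; not)
open import Data.Bool.Properties using (not-¬; ¬-not; ⇔→≡; T-≡; T-not-≡; not-injective)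
open import Data.Empty using (⊥; ⊥-elim)
open import Data.Fin as Fin using (Fin; toℕ; _≟_; _↑ʳ_; #_)
open import Data.Fin.Properties
  using ( ¬∀⟶∃¬; any?; all?; toℕ-injective; injective⇒≤; toℕ<n; toℕ-↑ˡ; toℕ-↑ʳ; ↑ʳ-injective
        ; splitAt⁻¹-↑ˡ; splitAt⁻¹-↑ʳ )
open import Data.Fin.Permutation as P using (Permutation; _⟨$⟩ʳ_; _⟨$⟩ˡ_; _∘ₚ_)
import Data.Fin.Permutation.Components as PC
open import Data.Fin.Subset using (Subset; _∈_; _∉_; _∪_; ⁅_⁆) renaming (⊥ to ∅)
open import Data.Fin.Subset.Properties using (x∈p∪q⁻; x∈p∪q⁺; x∈⁅x⁆; x∈⁅y⁆⇒x≡y; ∉⊥; _∈?_)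
open import Data.List using (List; []; _∷_; map; length; lookup; zip)
open import Data.List.Properties using (map-∘)
open import Data.List.Membership.Propositional using (find) renaming (_∈_ to _∈ₗ_; _∉_ to _∉ₗ_)
open import Data.List.Membership.Propositional.Properties using (∈-map⁺; ∈-map⁻; ∈-lookup)
open import Data.List.Relation.Unary.All as All using (All; []; _∷_)
open import Data.List.Relation.Unary.AllPairs using (AllPairs; []; _∷_)
open import Data.List.Relation.Unary.Any as Any using (Any; here; there)
open import Data.Nat as ℕ using (zero; suc; _+_; _∸_; _<_; z≤n; s≤s; z<s; s<s; s≤s⁻¹; _≤′_; ≤′-refl; ≤′-step)
open import Data.Nat.Properties
  using ( ≤-refl; ≤⇒≤′; <⇒≱; <⇒≢; n<1+n; n≤1+n; m<m+n; m≤m+n; +-comm; +-identityʳ; +-cancelˡ-≡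
        ; m+n≤o⇒m≤o∸n; m∸n+n≡m; m+n≤o⇒n≤o )
open import Data.Product as Product using (∃; ∃₂; ∃-syntax; _,_; proj₁; proj₂)
open import Data.Product.Function.NonDependent.Propositional using (_×-⇔_)
open import Data.Sum as Sum using (inj₁; inj₂; [_,_])
open import Data.Sum.Function.Propositional using (_⊎-⇔_)
open import Data.Unit using (⊤; tt)
open import Data.Vec.Properties using (lookup∘tabulate; []=⇒lookup; lookup⇒[]=)
open import Function using (_∘_; const; id; case_of_)
open import Function.Bundles using (Equivalence; Inverse; mk⇔)
open import Function.Construct.Composition using (_⇔-∘_)
open import Relation.Binary.PropositionalEquality
  using (_≡_; _≢_; refl; sym; trans; cong; cong₂; subst; subst₂; ≢-sym)
open import Relation.Nullary using (¬_; Dec; yes; no; contradiction)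
open import Relation.Nullary.Decidable as Dec
  using (⌊_⌋; decidable-stable; dec-true; dec-false; toWitness; fromWitness; fromWitnessFalse; _×-dec_; _⊎-dec_)

∨-true⁻ : ∀ {b c} → b ∨ c ≡ true → b ≡ true ⊎ c ≡ true
∨-true⁻ {true}  _ = inj₁ refl
∨-true⁻ {false} e = inj₂ e

∨-trueˡ : ∀ {b} c → b ≡ true → b ∨ c ≡ true
∨-trueˡ c refl = refl

∨-trueʳ : ∀ b {c} → c ≡ true → b ∨ c ≡ true
∨-trueʳ true  _ = refl
∨-trueʳ false e = e

∧-true⁻ : ∀ {b c} → b ∧ c ≡ true → b ≡ true × c ≡ true
∧-true⁻ {true} e = refl , e

∧-true⁺ : ∀ {b c} → b ≡ true → c ≡ true → b ∧ c ≡ true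
∧-true⁺ refl refl = refl

⌊⌋-true⁻ : ∀ {a} {A : Set a} (d : Dec A) → ⌊ d ⌋ ≡ true → A
⌊⌋-true⁻ d e = toWitness {a? = d} (Equivalence.from T-≡ e)

⌊⌋-true⁺ : ∀ {a} {A : Set a} (d : Dec A) → A → ⌊ d ⌋ ≡ true
⌊⌋-true⁺ d a = Equivalence.to T-≡ (fromWitness {a? = d} a)

⌊⌋-false⁺ : ∀ {a} {A : Set a} (d : Dec A) → ¬ A → ⌊ d ⌋ ≡ false
⌊⌋-false⁺ d ¬a = Equivalence.to T-not-≡ (fromWitnessFalse {a? = d} ¬a)

∈-map-injective : ∀ {A B : Set} {f : A → B} → (∀ {a b} → f a ≡ f b → a ≡ b) →
                  ∀ {x xs} → f x ∈ₗ map f xs → x ∈ₗ xs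
∈-map-injective {f = f} f-inj p with ∈-map⁻ f p
... | y , y∈xs , fx≡fy = subst (_∈ₗ _) (sym (f-inj fx≡fy)) y∈xs

lookup-injective : ∀ {A : Set} {xs : List A} → AllPairs _≢_ xs → ∀ {i j} → lookup xs i ≡ lookup xs j → i ≡ j
lookup-injective (_ ∷ _)  {Fin.zero}  {Fin.zero}  _ = refl
lookup-injective (x∉ ∷ _) {Fin.zero}  {Fin.suc j} e = contradiction e (All.lookup x∉ (∈-lookup j))
lookup-injective (x∉ ∷ _) {Fin.suc i} {Fin.zero}  e = contradiction (sym e) (All.lookup x∉ (∈-lookup i))
lookup-injective (_ ∷ d)  {Fin.suc i} {Fin.suc j} e = cong Fin.suc (lookup-injective d e)

distinct⇒length≤ : ∀ {m} {xs : List (Fin m)} → AllPairs _≢_ xs → length xs ≤ m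
distinct⇒length≤ d = injective⇒≤ (lookup-injective d)

size-split : ∀ t c {m} → t + c ≤ m → ∃ λ n → t ≤ n × m ≡ n + c
size-split t c {m} le = m ∸ c , m+n≤o⇒m≤o∸n t le , sym (m∸n+n≡m (m+n≤o⇒n≤o t le))

transpose-source : ∀ {n} (i j : Fin n) → PC.transpose i j i ≡ j
transpose-source i j rewrite dec-true (i ≟ i) refl = refl

transpose-fixes : ∀ {n} {i j k : Fin n} → k ≢ i → k ≢ j → PC.transpose i j k ≡ k
transpose-fixes {i = i} {j} {k} k≢i k≢j rewrite dec-false (k ≟ i) k≢i | dec-false (k ≟ j) k≢j = refl

permutation-injective : ∀ {k} (π : Permutation k k) {a b} → π ⟨$⟩ʳ a ≡ π ⟨$⟩ʳ b → a ≡ b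
permutation-injective π {a} {b} e = trans (sym (P.inverseˡ π)) (trans (cong (π ⟨$⟩ˡ_) e) (P.inverseˡ π))

extend-to-permutation : ∀ {k} (ps : List (Fin k × Fin k)) →
                        AllPairs _≢_ (map proj₁ ps) → AllPairs _≢_ (map proj₂ ps) →
                        ∃ λ (π : Permutation k k) → All (λ (x , y) → π ⟨$⟩ʳ x ≡ y) ps
extend-to-permutation [] _ _ = P.id , []
extend-to-permutation ((x , y) ∷ ps) (x∉ ∷ xs-distinct) (y∉ ∷ ys-distinct)
  with extend-to-permutation ps xs-distinct ys-distinct
... | π , π-maps = π ∘ₚ P.transpose (π ⟨$⟩ʳ x) y , transpose-source (π ⟨$⟩ʳ x) y ∷ still-maps ps π-maps x∉ y∉
  where
  -- The transposition of π x and y fixes the other images, which avoid both.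
  still-maps : ∀ qs → All (λ (x′ , y′) → π ⟨$⟩ʳ x′ ≡ y′) qs → All (x ≢_) (map proj₁ qs) → All (y ≢_) (map proj₂ qs) →
               All (λ (x′ , y′) → PC.transpose (π ⟨$⟩ʳ x) y (π ⟨$⟩ʳ x′) ≡ y′) qs
  still-maps [] [] [] [] = []
  still-maps ((x′ , y′) ∷ qs) (e ∷ es) (x≢x′ ∷ x∉′) (y≢y′ ∷ y∉′) =
    trans (cong (PC.transpose (π ⟨$⟩ʳ x) y) e)
          (transpose-fixes (λ y′≡πx → x≢x′ (permutation-injective π (trans (sym y′≡πx) (sym e)))) (≢-sym y≢y′)) ∷
    still-maps qs es x∉′ y∉′

↑ˡ-or-↑ʳ : ∀ n {t} (x : Fin (n + t)) → toℕ x < n ⊎ ∃ λ i → x ≡ n ↑ʳ i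
↑ˡ-or-↑ʳ n {t} x with Fin.splitAt n x in eq
... | inj₁ j = inj₁ (subst (λ y → toℕ y < n) (splitAt⁻¹-↑ˡ eq) (subst (_< n) (sym (toℕ-↑ˡ j t)) (toℕ<n j)))
... | inj₂ i = inj₂ (i , sym (splitAt⁻¹-↑ʳ eq))

toℕ-≢ : ∀ {N} {u v : Fin N} {i j} → toℕ u ≡ i → toℕ v ≡ j → i ≢ j → u ≢ v
toℕ-≢ refl refl i≢j u≡v = i≢j (cong toℕ u≡v)

↑ʳ-≢ : ∀ n {t} {i j : Fin t} → i ≢ j → n ↑ʳ i ≢ n ↑ʳ j
↑ʳ-≢ n i≢j = i≢j ∘ ↑ʳ-injective n _ _

toℕ-↑ʳ₀ : ∀ n {t} → toℕ (n ↑ʳ Fin.zero {t}) ≡ n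
toℕ-↑ʳ₀ n = trans (toℕ-↑ʳ n _) (+-identityʳ n)

toℕ-↑ʳ₁ : ∀ n {t} → toℕ (n ↑ʳ Fin.suc (Fin.zero {t})) ≡ suc n
toℕ-↑ʳ₁ n = trans (toℕ-↑ʳ n _) (+-comm n 1)

∈-∪⁅⁆⁻ : ∀ {n} {A : Subset n} {w v} → v ∈ A ∪ ⁅ w ⁆ → v ∈ A ⊎ v ≡ w
∈-∪⁅⁆⁻ {A = A} {w} p = Sum.map₂ (x∈⁅y⁆⇒x≡y w) (x∈p∪q⁻ A ⁅ w ⁆ p)

∈-∪⁅⁆⁺ˡ : ∀ {n} {A : Subset n} {w v} → v ∈ A → v ∈ A ∪ ⁅ w ⁆
∈-∪⁅⁆⁺ˡ p = x∈p∪q⁺ (inj₁ p)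

∈-∪⁅⁆⁺ʳ : ∀ {n} {A : Subset n} {w} → w ∈ A ∪ ⁅ w ⁆
∈-∪⁅⁆⁺ʳ {w = w} = x∈p∪q⁺ (inj₂ (x∈⁅x⁆ w))

∉-∪⁅⁆⁺ : ∀ {n} {A : Subset n} {w v} → v ∉ A → v ≢ w → v ∉ A ∪ ⁅ w ⁆
∉-∪⁅⁆⁺ v∉A v≢w p = [ v∉A , v≢w ] (∈-∪⁅⁆⁻ p)

∈⁅⁆⁻ : ∀ {n} {w v : Fin n} → v ∈ ∅ ∪ ⁅ w ⁆ → v ≡ w
∈⁅⁆⁻ p = [ (λ v∈∅ → contradiction v∈∅ ∉⊥) , id ] (∈-∪⁅⁆⁻ p)

∉⁅⁆⁺ : ∀ {n} {w v : Fin n} → v ≢ w → v ∉ ∅ ∪ ⁅ w ⁆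
∉⁅⁆⁺ = ∉-∪⁅⁆⁺ ∉⊥

∉⇒≢ : ∀ {n} {A : Subset n} {v w} → v ∉ A → w ∈ A → v ≢ w
∉⇒≢ v∉A w∈A refl = v∉A w∈A

module _ {m : ℕ} (G : Graph m) where

  Isolated : Fin m → Set
  Isolated u = ∀ v → G u v ≡ false

  -- N(a) ⊆ {s}; a may be isolated.
  Hangs : Fin m → Fin m → Set
  Hangs a s = ∀ v → G a v ≡ true → v ≡ s

  record PendantPair (s a b : Fin m) : Set where
    field
      a≢b : a ≢ b
      a≢s : a ≢ s
      b≢s : b ≢ s
      a-hangs : Hangs a s
      b-hangs : Hangs b s

  -- The configurations inside A from which Staller, moving first, wins in two moves.
  data Threat (A : Fin m → Set) : Set where
    isolated    : ∀ {u} → A u → Isolated u → Threat A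
    pendantPair : ∀ {s a b} → A s → A a → A b → PendantPair s a b → Threat A

threat-mono : ∀ {m} {G : Graph m} {A B : Fin m → Set} →
              (∀ {v} → A v → B v) → Threat G A → Threat G B
threat-mono A⊆B (isolated Au iso) = isolated (A⊆B Au) iso
threat-mono A⊆B (pendantPair As Aa Ab pp) = pendantPair (A⊆B As) (A⊆B Aa) (A⊆B Ab) pp

hangs⇒adjacent : ∀ {m} (G : Graph m) {a s} → Hangs G a s → ¬ Isolated G a → G a s ≡ true
hangs⇒adjacent G {a} {s} h ¬iso = ¬-not λ a≁s →
  ¬iso λ v → ¬-not λ e → not-¬ (subst (λ w → G a w ≡ true) (h v e) e) a≁s

module _ {m : ℕ} (G : Graph m) (x y : Fin m) where

  private
    G⁺ = addEdge G x y

  addEdge-⊇ : ∀ {i j} → G i j ≡ true → G⁺ i j ≡ true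
  addEdge-⊇ e = ∨-trueˡ _ e

  addEdge-xy : G⁺ x y ≡ true
  addEdge-xy = ∨-trueʳ (G x y) (∨-trueˡ _ (∧-true⁺ (⌊⌋-true⁺ (x ≟ x) refl) (⌊⌋-true⁺ (y ≟ y) refl)))

  addEdge-yx : G⁺ y x ≡ true
  addEdge-yx = ∨-trueʳ (G y x) (∨-trueʳ _ (∧-true⁺ (⌊⌋-true⁺ (y ≟ y) refl) (⌊⌋-true⁺ (x ≟ x) refl)))

  addEdge⁻ : ∀ {i j} → G⁺ i j ≡ true → G i j ≡ true ⊎ (i ≡ x × j ≡ y) ⊎ (i ≡ y × j ≡ x)
  addEdge⁻ {i} {j} e with ∨-true⁻ {G i j} e
  ... | inj₁ old = inj₁ old
  ... | inj₂ new with ∨-true⁻ {⌊ i ≟ x ⌋ ∧ ⌊ j ≟ y ⌋} new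
  ...   | inj₁ xy = let (i≡x , j≡y) = ∧-true⁻ xy in inj₂ (inj₁ (⌊⌋-true⁻ (i ≟ x) i≡x , ⌊⌋-true⁻ (j ≟ y) j≡y))
  ...   | inj₂ yx = let (i≡y , j≡x) = ∧-true⁻ yx in inj₂ (inj₂ (⌊⌋-true⁻ (i ≟ y) i≡y , ⌊⌋-true⁻ (j ≟ x) j≡x))

  addEdge-simple : IsSimple G → x ≢ y → IsSimple G⁺
  addEdge-simple simple x≢y = record
    { symmetric   = λ i j → ⇔→≡ (mk⇔ (flip i j) (flip j i))
    ; irreflexive = λ i → ¬-not (loop i ∘ addEdge⁻)
    }
    where
    open IsSimple simple
    flip : ∀ i j → G⁺ i j ≡ true → G⁺ j i ≡ true
    flip i j e with addEdge⁻ e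
    ... | inj₁ old = addEdge-⊇ (trans (symmetric j i) old)
    ... | inj₂ (inj₁ (refl , refl)) = addEdge-yx
    ... | inj₂ (inj₂ (refl , refl)) = addEdge-xy
    loop : ∀ i → ¬ (G i i ≡ true ⊎ (i ≡ x × i ≡ y) ⊎ (i ≡ y × i ≡ x))
    loop i (inj₁ e) = not-¬ e (irreflexive i)
    loop i (inj₂ (inj₁ (refl , refl))) = x≢y refl
    loop i (inj₂ (inj₂ (refl , refl))) = x≢y refl

  hangs-addEdge : ∀ {a s} → Hangs G a s → a ≢ x → a ≢ y → Hangs G⁺ a s
  hangs-addEdge hangs a≢x a≢y v e with addEdge⁻ e
  ... | inj₁ old = hangs v old
  ... | inj₂ (inj₁ (a≡x , _)) = contradiction a≡x a≢x
  ... | inj₂ (inj₂ (a≡y , _)) = contradiction a≡y a≢y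

  isolated-addEdge : ∀ {u} → Isolated G u → u ≢ x → u ≢ y → Isolated G⁺ u
  isolated-addEdge iso u≢x u≢y v = ¬-not λ e → case addEdge⁻ e of λ where
    (inj₁ old)                → not-¬ old (iso v)
    (inj₂ (inj₁ (u≡x , _))) → u≢x u≡x
    (inj₂ (inj₂ (u≡y , _))) → u≢y u≡y

  isolated-addEdge⁻ : ∀ {u} → Isolated G⁺ u → Isolated G u
  isolated-addEdge⁻ iso v = ¬-not (λ e → not-¬ (addEdge-⊇ e) (iso v))

  pendantPair-addEdge : ∀ {s a b} → PendantPair G s a b → a ≢ x → a ≢ y → b ≢ x → b ≢ y →
                        PendantPair G⁺ s a b
  pendantPair-addEdge pp a≢x a≢y b≢x b≢y = record
    { a≢b = a≢b ; a≢s = a≢s ; b≢s = b≢s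
    ; a-hangs = hangs-addEdge a-hangs a≢x a≢y
    ; b-hangs = hangs-addEdge b-hangs b≢x b≢y
    }
    where open PendantPair pp

-- The game

module _ {m : ℕ} (G : Graph m) where
  open Game G

  dturn-suc : ∀ {k D S} → DTurn k D S → DTurn (suc k) D S
  sturn-suc : ∀ {k D S} → STurn k D S → STurn (suc k) D S

  dturn-suc (nd , reply) = nd , λ v v∉D v∉S → Product.map₂ sturn-suc (reply v v∉D v∉S)

  sturn-suc {suc k} (v , v∉D , v∉S , next) = v , v∉D , v∉S , Sum.map₂ dturn-suc next

stallerWinsD-suc : ∀ {m} {G : Graph m} {k} → StallerWinsD G k → StallerWinsD G (suc k)
stallerWinsD-suc {G = G} = dturn-suc G

stallerWinsS-suc : ∀ {m} {G : Graph m} {k} → StallerWinsS G k → StallerWinsS G (suc k)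
stallerWinsS-suc {G = G} = sturn-suc G

≤-upward : ∀ {p} (P : ℕ → Set p) → (∀ {k} → P k → P (suc k)) → ∀ {j k} → j ≤ k → P j → P k
≤-upward P step j≤k = go (≤⇒≤′ j≤k)
  where
  go : ∀ {j k} → j ≤′ k → P j → P k
  go ≤′-refl       p = p
  go (≤′-step j≤k) p = step (go j≤k p)

module _ (W : ∀ {m} → Graph m → ℕ → Set) (W-suc : ∀ {m} {G : Graph m} {k} → W G k → W G (suc k)) where

  critical-2⇔ : ∀ {m} {G : Graph m} →
                Critical W 2 G ⇔
                (W G 2 × ¬ W G 1 × (∀ x y → x ≢ y → G x y ≡ false → ¬ W (addEdge G x y) 2))
  critical-2⇔ = mk⇔
    (λ ((w₂ , below) , edges) → w₂ , below 1 (s≤s (s≤s z≤n)) , λ x y x≢y x≁y → edges x y x≢y x≁y 2 ≤-refl)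
    (λ (w₂ , ¬w₁ , edges) → (w₂ , λ j j<2 w → ¬w₁ (up (s≤s⁻¹ j<2) w)) ,
                            λ x y x≢y x≁y j j≤2 w → edges x y x≢y x≁y (up j≤2 w))
    where
    up : ∀ {m} {H : Graph m} {j k} → j ≤ k → W H j → W H k
    up {H = H} = ≤-upward (W H) W-suc

module GameProperties {m : ℕ} {G : Graph m} (simple : IsSimple G) where
  open Game G
  open IsSimple simple

  _dominates_ : Fin m → Fin m → Set
  u dominates v = u ≡ v ⊎ G u v ≡ true

  dominates-sym : ∀ {u v} → u dominates v → v dominates u
  dominates-sym (inj₁ refl) = inj₁ refl
  dominates-sym {u} {v} (inj₂ e) = inj₂ (trans (symmetric v u) e)

  N[_]⊆_ : Fin m → (Fin m → Set) → Set
  N[ u ]⊆ P = ∀ v → u dominates v → P v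

  ∈N[]⁻ : ∀ {u v} → v ∈ N[ u ] → u dominates v
  ∈N[]⁻ {u} {v} p with ∨-true⁻ (trans (sym (lookup∘tabulate _ v)) ([]=⇒lookup p))
  ... | inj₁ e = inj₁ (sym (⌊⌋-true⁻ (v ≟ u) e))
  ... | inj₂ e = inj₂ e

  ∈N[]⁺ : ∀ {u v} → u dominates v → v ∈ N[ u ]
  ∈N[]⁺ {u} {v} d = lookup⇒[]= v _ (trans (lookup∘tabulate _ v) (bit d))
    where
    bit : u dominates v → ⌊ v ≟ u ⌋ ∨ G u v ≡ true
    bit (inj₁ refl) = ∨-trueˡ _ (⌊⌋-true⁺ (v ≟ v) refl)
    bit (inj₂ e)    = ∨-trueʳ _ e

  won⁺ : ∀ {u S} → N[ u ]⊆ (_∈ S) → StallerWon S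
  won⁺ {u} h = u , λ {v} p → h v (∈N[]⁻ p)

  won⁻ : ∀ {S} → StallerWon S → ∃ λ u → N[ u ]⊆ (_∈ S)
  won⁻ (u , h) = u , λ v d → h (∈N[]⁺ d)

  undominated⇒¬dominating : ∀ {u D} → N[ u ]⊆ (_∉ D) → ¬ Dominating D
  undominated⇒¬dominating {u} h dom =
    let (v , v∈D , v-dominates-u) = dom u in h v (dominates-sym v-dominates-u) v∈D

  ¬dominating⇒undominated : ∀ {D} → ¬ Dominating D → ∃ λ u → N[ u ]⊆ (_∉ D)
  ¬dominating⇒undominated {D} nd =
    let (u , ¬dom) = ¬∀⟶∃¬ m _ (λ u → any? (λ v → (v ∈? D) ×-dec dominates? v u)) nd
    in u , λ v d v∈D → ¬dom (v , v∈D , dominates-sym d)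
    where
    dominates? : ∀ u v → Dec (u dominates v)
    dominates? u v = (u ≟ v) ⊎-dec (G u v Bool.≟ true)

  dturn-0 : ∀ {D S} → DTurn 0 D S → StallerWon S
  dturn-0 {D} {S} (nd , reply) with ¬dominating⇒undominated nd
  ... | u , u-free = won⁺ λ v d → claimed v (u-free v d)
    where
    claimed : ∀ v → v ∉ D → v ∈ S
    claimed v v∉D with v ∈? S
    ... | yes v∈S = v∈S
    ... | no  v∉S = ⊥-elim (proj₂ (reply v v∉D v∉S))

  sturn-1 : ∀ {D S} → STurn 1 D S → ∃ λ c → c ∉ D × c ∉ S × StallerWon (S ∪ ⁅ c ⁆)
  sturn-1 (c , c∉D , c∉S , next) = c , c∉D , c∉S , [ id , dturn-0 ] next

  claim-last : ∀ {k D S u c} → c ∉ D → c ∉ S → N[ u ]⊆ (λ v → v ∈ S ⊎ v ≡ c) → STurn (suc k) D S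
  claim-last c∉D c∉S h =
    _ , c∉D , c∉S , inj₁ (won⁺ λ v d → [ ∈-∪⁅⁆⁺ˡ , (λ { refl → ∈-∪⁅⁆⁺ʳ }) ] (h v d))

  isolated⇒N⊆ : ∀ {u} → Isolated G u → N[ u ]⊆ (_≡ u)
  isolated⇒N⊆ iso v (inj₁ refl) = refl
  isolated⇒N⊆ iso v (inj₂ e)    = contradiction (iso v) (not-¬ e)

  hangs⇒N⊆ : ∀ {a s} → Hangs G a s → N[ a ]⊆ (λ v → v ≡ s ⊎ v ≡ a)
  hangs⇒N⊆ h v (inj₁ refl) = inj₂ refl
  hangs⇒N⊆ h v (inj₂ e)    = inj₁ (h v e)

  claim-isolated : ∀ {k D S u} → Isolated G u → u ∉ D → u ∉ S → STurn (suc k) D S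
  claim-isolated iso u∉D u∉S = claim-last u∉D u∉S λ v d → inj₂ (isolated⇒N⊆ iso v d)

  claim-leaf : ∀ {k D S a s} → Hangs G a s → s ∈ S → a ∉ D → a ∉ S → STurn (suc k) D S
  claim-leaf h s∈S a∉D a∉S = claim-last a∉D a∉S λ v d → Sum.map₁ (λ { refl → s∈S }) (hangs⇒N⊆ h v d)

  isolated⇒¬dominating : ∀ {D u} → Isolated G u → u ∉ D → ¬ Dominating D
  isolated⇒¬dominating iso u∉D = undominated⇒¬dominating λ v d → subst (_∉ _) (sym (isolated⇒N⊆ iso v d)) u∉D

  leaf⇒¬dominating : ∀ {D a s} → Hangs G a s → a ∉ D → s ∉ D → ¬ Dominating D
  leaf⇒¬dominating h a∉D s∉D = undominated⇒¬dominating λ v d →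
    [ (λ { refl → s∉D }) , (λ { refl → a∉D }) ] (hangs⇒N⊆ h v d)

  -- Whichever leaf Dominator takes, Staller takes the other one.
  double-threat : ∀ {D S s a b} → PendantPair G s a b → s ∈ S → s ∉ D → a ∉ D → b ∉ D → a ∉ S → b ∉ S →
                  DTurn 1 D S
  double-threat {D} {S} {s} {a} {b} pp s∈S s∉D a∉D b∉D a∉S b∉S = leaf⇒¬dominating a-hangs a∉D s∉D , reply
    where
    open PendantPair pp
    s-free : ∀ {w} → w ∉ S → s ∉ D ∪ ⁅ w ⁆
    s-free w∉S = ∉-∪⁅⁆⁺ s∉D (≢-sym (∉⇒≢ w∉S s∈S))
    reply : ∀ w → w ∉ D → w ∉ S → ¬ Dominating (D ∪ ⁅ w ⁆) × STurn 1 (D ∪ ⁅ w ⁆) S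
    reply w w∉D w∉S with a ≟ w
    ... | yes refl = let b∉D′ = ∉-∪⁅⁆⁺ b∉D (≢-sym a≢b) in
      leaf⇒¬dominating b-hangs b∉D′ (s-free w∉S) , claim-leaf b-hangs s∈S b∉D′ b∉S
    ... | no a≢w   = let a∉D′ = ∉-∪⁅⁆⁺ a∉D a≢w in
      leaf⇒¬dominating a-hangs a∉D′ (s-free w∉S) , claim-leaf a-hangs s∈S a∉D′ a∉S

  threat⇒¬dominating : ∀ {A D} → Threat G A → (∀ {v} → A v → v ∉ D) → ¬ Dominating D
  threat⇒¬dominating (isolated Au iso) free = isolated⇒¬dominating iso (free Au)
  threat⇒¬dominating (pendantPair As Aa _ pp) free = leaf⇒¬dominating (PendantPair.a-hangs pp) (free Aa) (free As)

  threat⇒sturn-2 : ∀ {A D S} → Threat G A → (∀ {v} → A v → v ∉ D × v ∉ S) → STurn 2 D S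
  threat⇒sturn-2 (isolated Au iso) free = claim-isolated iso (proj₁ (free Au)) (proj₂ (free Au))
  threat⇒sturn-2 (pendantPair As Aa Ab pp) free =
    _ , proj₁ (free As) , proj₂ (free As) ,
    inj₂ (double-threat pp ∈-∪⁅⁆⁺ʳ (proj₁ (free As)) (proj₁ (free Aa)) (proj₁ (free Ab))
                        (∉-∪⁅⁆⁺ (proj₂ (free Aa)) a≢s) (∉-∪⁅⁆⁺ (proj₂ (free Ab)) b≢s))
    where open PendantPair pp

  N⊆⁅⁆⇒isolated : ∀ {u c} → N[ u ]⊆ (_≡ c) → Isolated G c
  N⊆⁅⁆⇒isolated {u} h v with h u (inj₁ refl)
  ... | refl = ¬-not λ e → not-¬ (subst (λ w → G u w ≡ true) (h v (inj₂ e)) e) (irreflexive u)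

  won-⁅⁆ : ∀ {c} → StallerWon (∅ ∪ ⁅ c ⁆) → Isolated G c
  won-⁅⁆ won = let (u , h) = won⁻ won in N⊆⁅⁆⇒isolated λ v d → ∈⁅⁆⁻ (h v d)

  won-⁅⁆⁅⁆ : ∀ {s c} → StallerWon ((∅ ∪ ⁅ s ⁆) ∪ ⁅ c ⁆) → ∃ λ u → N[ u ]⊆ (λ v → v ≡ s ⊎ v ≡ c)
  won-⁅⁆⁅⁆ won = let (u , h) = won⁻ won in u , λ v d → Sum.map₁ ∈⁅⁆⁻ (∈-∪⁅⁆⁻ (h v d))

  N⊆⇒hangs : ∀ {c s} → N[ c ]⊆ (λ v → v ≡ s ⊎ v ≡ c) → Hangs G c s
  N⊆⇒hangs {c} h v e with h v (inj₂ e)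
  ... | inj₁ v≡s  = v≡s
  ... | inj₂ refl = contradiction (irreflexive c) (not-¬ e)

  N⊆⇒neighbour : ∀ {c s} → N[ s ]⊆ (λ v → v ≡ s ⊎ v ≡ c) → Hangs G s c
  N⊆⇒neighbour {c} {s} h v e with h v (inj₂ e)
  ... | inj₁ refl = contradiction (irreflexive s) (not-¬ e)
  ... | inj₂ v≡c  = v≡c

  hangs-on-lonely : ∀ {c s c′} → Hangs G c s → Hangs G s c′ → c ≢ c′ → Isolated G c
  hangs-on-lonely {c} {s} hc hs c≢c′ v = ¬-not λ e →
    c≢c′ (hs c (trans (symmetric s c) (subst (λ w → G c w ≡ true) (hc v e) e)))

  -- Staller's answers c₁, c₂ to Dominator's replies w and c₁ after her first move s.
  answers⇒threat : ∀ {s c₁ c₂ u₁ u₂} → c₁ ≢ c₂ → c₁ ≢ s → c₂ ≢ s →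
                   N[ u₁ ]⊆ (λ v → v ≡ s ⊎ v ≡ c₁) → N[ u₂ ]⊆ (λ v → v ≡ s ⊎ v ≡ c₂) →
                   Threat G (λ v → v ≡ s ⊎ v ≡ c₁ ⊎ v ≡ c₂)
  answers⇒threat {s} {c₁} {c₂} {u₁} {u₂} c₁≢c₂ c₁≢s c₂≢s h₁ h₂ with h₁ u₁ (inj₁ refl) | h₂ u₂ (inj₁ refl)
  ... | inj₂ refl | inj₂ refl =
    pendantPair (inj₁ refl) (inj₂ (inj₁ refl)) (inj₂ (inj₂ refl))
                (record { a≢b = c₁≢c₂ ; a≢s = c₁≢s ; b≢s = c₂≢s ; a-hangs = N⊆⇒hangs h₁ ; b-hangs = N⊆⇒hangs h₂ })
  ... | inj₂ refl | inj₁ refl = isolated (inj₂ (inj₁ refl)) (hangs-on-lonely (N⊆⇒hangs h₁) (N⊆⇒neighbour h₂) c₁≢c₂)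
  ... | inj₁ refl | inj₂ refl =
    isolated (inj₂ (inj₂ refl)) (hangs-on-lonely (N⊆⇒hangs h₂) (N⊆⇒neighbour h₁) (≢-sym c₁≢c₂))
  ... | inj₁ refl | inj₁ refl = isolated (inj₁ refl) λ v → ¬-not λ e →
    c₁≢c₂ (trans (sym (N⊆⇒neighbour h₁ v e)) (N⊆⇒neighbour h₂ v e))

  -- The position after Staller's first move s: A holds the vertices Dominator has not taken,
  -- some N[u] lies in A since Dominator has not won yet, and every reply w is answered by a
  -- winning move c.
  forced-threat : ∀ {A : Fin m → Set} → (∀ v → Dec (A v)) → ∀ {s} → A s → (∃ λ u → N[ u ]⊆ A) →
                  (∀ w → A w → w ≢ s → ∃ λ c → A c × c ≢ w × c ≢ s × ∃ λ u → N[ u ]⊆ (λ v → v ≡ s ⊎ v ≡ c)) →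
                  Threat G A
  forced-threat {A} A? {s} A-s (u , trapped) answer with any? (λ w → A? w ×-dec Dec.¬? (w ≟ s))
  ... | yes (w , A-w , w≢s) =
    let (c₁ , A-c₁ , _      , c₁≢s , _ , h₁) = answer w A-w w≢s
        (c₂ , A-c₂ , c₂≢c₁ , c₂≢s , _ , h₂) = answer c₁ A-c₁ c₁≢s
    in threat-mono (λ { (inj₁ refl) → A-s ; (inj₂ (inj₁ refl)) → A-c₁ ; (inj₂ (inj₂ refl)) → A-c₂ })
                   (answers⇒threat (≢-sym c₂≢c₁) c₁≢s c₂≢s h₁ h₂)
  ... | no none = isolated A-s (N⊆⁅⁆⇒isolated only-s)
    where
    only-s : N[ u ]⊆ (_≡ s)
    only-s v d with v ≟ s
    ... | yes v≡s = v≡s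
    ... | no  v≢s = ⊥-elim (none (v , trapped v d , v≢s))

  stallerWinsS-1⇔ : StallerWinsS G 1 ⇔ ∃ (Isolated G)
  stallerWinsS-1⇔ = mk⇔ (λ w → let (c , _ , _ , won) = sturn-1 w in c , won-⁅⁆ won)
                        (λ (u , iso) → claim-isolated iso ∉⊥ ∉⊥)

  stallerWinsS-2⇔ : StallerWinsS G 2 ⇔ Threat G (λ _ → ⊤)
  stallerWinsS-2⇔ = mk⇔ to (λ t → threat⇒sturn-2 t (const (∉⊥ , ∉⊥)))
    where
    to : StallerWinsS G 2 → Threat G (λ _ → ⊤)
    to (s , _ , _ , inj₁ won) = isolated tt (won-⁅⁆ won)
    to (s , _ , _ , inj₂ (_ , reply)) = forced-threat (const (yes tt)) tt (s , λ _ _ → tt) answer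
      where
      answer : ∀ w → ⊤ → w ≢ s → _
      answer w _ w≢s =
        let (c , c∉D , c∉S , won) = sturn-1 (proj₂ (reply w ∉⊥ (∉⁅⁆⁺ w≢s)))
        in c , tt , ∉⇒≢ c∉D ∈-∪⁅⁆⁺ʳ , ∉⇒≢ c∉S ∈-∪⁅⁆⁺ʳ , won-⁅⁆⁅⁆ won

  stallerWinsD-1⇔ : StallerWinsD G 1 ⇔ (∃₂ λ u v → u ≢ v × Isolated G u × Isolated G v)
  stallerWinsD-1⇔ = mk⇔ to from
    where
    to : StallerWinsD G 1 → ∃₂ λ u v → u ≢ v × Isolated G u × Isolated G v
    to (nd , reply) =
      let (u₀ , _)            = ¬dominating⇒undominated nd
          (u , u≢u₀ , iso-u) = isolated-avoiding u₀
          (v , v≢u , iso-v)  = isolated-avoiding u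
      in u , v , ≢-sym v≢u , iso-u , iso-v
      where
      isolated-avoiding : ∀ d → ∃ λ c → c ≢ d × Isolated G c
      isolated-avoiding d =
        let (c , c∉D , _ , won) = sturn-1 (proj₂ (reply d ∉⊥ ∉⊥)) in c , ∉⇒≢ c∉D ∈-∪⁅⁆⁺ʳ , won-⁅⁆ won
    from : (∃₂ λ u v → u ≢ v × Isolated G u × Isolated G v) → StallerWinsD G 1
    from (u , v , u≢v , iso-u , iso-v) = isolated⇒¬dominating iso-u ∉⊥ , reply
      where
      reply : ∀ d → d ∉ ∅ → d ∉ ∅ → ¬ Dominating (∅ ∪ ⁅ d ⁆) × STurn 1 (∅ ∪ ⁅ d ⁆) ∅
      reply d _ _ with u ≟ d
      ... | yes refl = isolated⇒¬dominating iso-v (∉⁅⁆⁺ (≢-sym u≢v)) , claim-isolated iso-v (∉⁅⁆⁺ (≢-sym u≢v)) ∉⊥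
      ... | no  u≢d  = isolated⇒¬dominating iso-u (∉⁅⁆⁺ u≢d) , claim-isolated iso-u (∉⁅⁆⁺ u≢d) ∉⊥

  stallerWinsD-2⇔ : StallerWinsD G 2 ⇔ (Fin m × ∀ d → Threat G (_≢ d))
  stallerWinsD-2⇔ = mk⇔ to from
    where
    to : StallerWinsD G 2 → Fin m × ∀ d → Threat G (_≢ d)
    to (nd , reply) = proj₁ (¬dominating⇒undominated nd) , threat-avoiding
      where
      threat-avoiding : ∀ d → Threat G (_≢ d)
      threat-avoiding d with proj₂ (reply d ∉⊥ ∉⊥)
      ... | s , s∉D , _ , inj₁ won = isolated (∉⇒≢ s∉D ∈-∪⁅⁆⁺ʳ) (won-⁅⁆ won)
      ... | s , s∉D , _ , inj₂ (nd′ , reply′) =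
        let (u , u-free) = ¬dominating⇒undominated nd′ in
        forced-threat (λ v → Dec.¬? (v ≟ d)) (∉⇒≢ s∉D ∈-∪⁅⁆⁺ʳ)
                      (u , λ v dom → ∉⇒≢ (u-free v dom) ∈-∪⁅⁆⁺ʳ) answer
        where
        answer : ∀ w → w ≢ d → w ≢ s → _
        answer w w≢d w≢s =
          let (c , c∉D , c∉S , won) = sturn-1 (proj₂ (reply′ w (∉⁅⁆⁺ w≢d) (∉⁅⁆⁺ w≢s)))
          in c , ∉⇒≢ c∉D (∈-∪⁅⁆⁺ˡ ∈-∪⁅⁆⁺ʳ) , ∉⇒≢ c∉D ∈-∪⁅⁆⁺ʳ , ∉⇒≢ c∉S ∈-∪⁅⁆⁺ʳ , won-⁅⁆⁅⁆ won
    from : Fin m × (∀ d → Threat G (_≢ d)) → StallerWinsD G 2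
    from (v₀ , threats) = undominated⇒¬dominating {v₀} (λ _ _ → ∉⊥) , λ d _ _ →
      threat⇒¬dominating (threats d) ∉⁅⁆⁺ , threat⇒sturn-2 (threats d) (λ v≢d → ∉⁅⁆⁺ v≢d , ∉⊥)

-- Cliques with pendant pairs

module _ {m : ℕ} (G : Graph m) where

  -- Within P, G is the clique P ∖ {a, b}, which contains s, together with the leaves a, b of s.
  -- G'_n is the case where P is everything; G'_n ∪ K_1 and G''_n consist of one and two such pieces.
  record PendantClique (P : Fin m → Set) (s a b : Fin m) : Set where
    field
      pair   : PendantPair G s a b
      P-s    : P s
      P-a    : P a
      P-b    : P b
      a~s    : G a s ≡ true
      b~s    : G b s ≡ true
      clique : ∀ {v w} → P v → P w → v ≢ w → v ≢ a → v ≢ b → w ≢ a → w ≢ b → G v w ≡ true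
    open PendantPair pair public

  Gn′Shape : Fin m → Fin m → Fin m → Set
  Gn′Shape = PendantClique (λ _ → ⊤)

  record Gn′∪K1Shape (z s a b : Fin m) : Set where
    field
      z-isolated : Isolated G z
      rest       : PendantClique (_≢ z) s a b

  record Gn″Shape (s₁ a₁ b₁ s₂ a₂ b₂ : Fin m) : Set where
    field
      s₁≢s₂  : s₁ ≢ s₂
      first  : PendantClique (λ v → v ≢ a₂ × v ≢ b₂) s₁ a₁ b₁
      second : PendantClique (λ v → v ≢ a₁ × v ≢ b₁) s₂ a₂ b₂

¬three-in-pair : ∀ {A : Set} {a b u v w : A} → (u ≡ a ⊎ u ≡ b) → (v ≡ a ⊎ v ≡ b) → (w ≡ a ⊎ w ≡ b) →
                 u ≢ v → u ≢ w → v ≢ w → ⊥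
¬three-in-pair (inj₁ refl) (inj₁ refl) _           u≢v _   _   = u≢v refl
¬three-in-pair (inj₂ refl) (inj₂ refl) _           u≢v _   _   = u≢v refl
¬three-in-pair (inj₁ refl) (inj₂ refl) (inj₁ refl) _   u≢w _   = u≢w refl
¬three-in-pair (inj₁ refl) (inj₂ refl) (inj₂ refl) _   _   v≢w = v≢w refl
¬three-in-pair (inj₂ refl) (inj₁ refl) (inj₁ refl) _   _   v≢w = v≢w refl
¬three-in-pair (inj₂ refl) (inj₁ refl) (inj₂ refl) _   u≢w _   = u≢w refl

in-pair? : ∀ {m} (a b v : Fin m) → Dec (v ≡ a ⊎ v ≡ b)
in-pair? a b v = (v ≟ a) ⊎-dec (v ≟ b)

module _ {m : ℕ} {G : Graph m} (simple : IsSimple G) where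
  open IsSimple simple

  pendantPairs-apart : ∀ {s₁ a₁ b₁ s₂ a₂ b₂} → PendantPair G s₁ a₁ b₁ → G a₂ s₂ ≡ true → G b₂ s₂ ≡ true →
                       s₂ ≢ s₁ → a₂ ≢ s₁ → (a₁ ≢ a₂ × a₁ ≢ b₂) × (b₁ ≢ a₂ × b₁ ≢ b₂) × (s₂ ≢ a₁ × s₂ ≢ b₁)
  pendantPairs-apart pp₁ a₂~s₂ b₂~s₂ s₂≢s₁ a₂≢s₁ =
      (s₂≢s₁ ∘ shared-leaf a-hangs a₂~s₂ , s₂≢s₁ ∘ shared-leaf a-hangs b₂~s₂)
    , (s₂≢s₁ ∘ shared-leaf b-hangs a₂~s₂ , s₂≢s₁ ∘ shared-leaf b-hangs b₂~s₂)
    , (a₂≢s₁ ∘ leaf-neighbour a-hangs a₂~s₂ , a₂≢s₁ ∘ leaf-neighbour b-hangs a₂~s₂)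
    where
    open PendantPair pp₁
    shared-leaf : ∀ {h s h′ t} → Hangs G h s → G h′ t ≡ true → h ≡ h′ → t ≡ s
    shared-leaf hangs e refl = hangs _ e
    leaf-neighbour : ∀ {h s v t} → Hangs G h s → G v t ≡ true → t ≡ h → v ≡ s
    leaf-neighbour {v = v} hangs e refl = hangs v (trans (symmetric _ v) e)

module PendantCliqueProperties {m : ℕ} {G : Graph m} (simple : IsSimple G)
                               {P : Fin m → Set} {s a b : Fin m} (pc : PendantClique G P s a b) where
  open IsSimple simple
  open PendantClique pc

  around : ∀ {v} → P v → v ≢ s → G v s ≡ true
  around {v} P-v v≢s with v ≟ a | v ≟ b
  ... | yes refl | _        = a~s
  ... | no _     | yes refl = b~s
  ... | no v≢a   | no v≢b   = clique P-v P-s v≢s v≢a v≢b (≢-sym a≢s) (≢-sym b≢s)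

  isolated⇒∉ : ∀ {u} → Isolated G u → ¬ P u
  isolated⇒∉ {u} iso P-u with u ≟ s
  ... | yes refl = not-¬ (trans (symmetric u a) a~s) (iso a)
  ... | no u≢s   = not-¬ (around P-u u≢s) (iso s)

  -- Vertices of P other than s are adjacent to s, and s has the two neighbours a ≢ b.
  leaf-outside : ∀ {H : Graph m} → (∀ {i j} → G i j ≡ true → H i j ≡ true) →
                 ∀ {h s′} → Hangs H h s′ → s′ ≢ s → ¬ P h
  leaf-outside G⊆H {h} {s′} hangs s′≢s P-h with h ≟ s
  ... | yes refl = a≢b (trans (hangs a (G⊆H (trans (symmetric h a) a~s)))
                              (sym (hangs b (G⊆H (trans (symmetric h b) b~s)))))
  ... | no  h≢s  = s′≢s (sym (hangs s (G⊆H (around P-h h≢s))))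

  module AfterEdge {x y : Fin m} (P-x : P x) (P-y : P y) (x≢y : x ≢ y) (x≁y : G x y ≡ false) where
    private
      G⁺ = addEdge G x y

    x≢s : x ≢ s
    x≢s refl = not-¬ (trans (symmetric x y) (around P-y (≢-sym x≢y))) x≁y

    y≢s : y ≢ s
    y≢s refl = not-¬ (around P-x x≢y) x≁y

    module _ {s′ a′ b′} (pp′ : PendantPair G⁺ s′ a′ b′) (P-a′ : P a′) (P-b′ : P b′) where
      open PendantPair pp′
        renaming (a≢b to a′≢b′; a≢s to a′≢s′; b≢s to b′≢s′; a-hangs to a′-hangs; b-hangs to b′-hangs)

      s′≡s : s′ ≡ s
      s′≡s with s′ ≟ s
      ... | yes s′≡s = s′≡s
      ... | no  s′≢s = contradiction P-a′ (leaf-outside (addEdge-⊇ G x y) a′-hangs s′≢s)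

      a′≢s : a′ ≢ s
      a′≢s a′≡s = a′≢s′ (trans a′≡s (sym s′≡s))

      b′≢s : b′ ≢ s
      b′≢s b′≡s = b′≢s′ (trans b′≡s (sym s′≡s))

      leaf≢x : ∀ {h} → Hangs G⁺ h s′ → h ≢ x
      leaf≢x hangs refl = y≢s (trans (hangs y (addEdge-xy G x y)) s′≡s)

      leaf≢y : ∀ {h} → Hangs G⁺ h s′ → h ≢ y
      leaf≢y hangs refl = x≢s (trans (hangs x (addEdge-yx G x y)) s′≡s)

      -- A leaf h of G⁺ outside {a, b} is adjacent in G to all other vertices of P ∖ {a, b}, so these are s.
      squeezed : ∀ {h} → Hangs G⁺ h s′ → P h → ¬ (h ≡ a ⊎ h ≡ b) →
                 ∀ {w} → P w → w ≢ h → w ≢ s → w ≡ a ⊎ w ≡ b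
      squeezed {h} hangs P-h h∉ {w} P-w w≢h w≢s with in-pair? a b w
      ... | yes w∈ = w∈
      ... | no  w∉ = contradiction
        (trans (hangs w (addEdge-⊇ G x y
                 (clique P-h P-w (≢-sym w≢h) (h∉ ∘ inj₁) (h∉ ∘ inj₂) (w∉ ∘ inj₁) (w∉ ∘ inj₂))))
               s′≡s)
        w≢s

      no-pendantPair : ⊥
      no-pendantPair with in-pair? a b a′ | in-pair? a b b′
      ... | no a′∉ | _ =
        ¬three-in-pair (squeezed a′-hangs P-a′ a′∉ P-b′ (≢-sym a′≢b′) b′≢s)
                       (squeezed a′-hangs P-a′ a′∉ P-x (≢-sym (leaf≢x a′-hangs)) x≢s)
                       (squeezed a′-hangs P-a′ a′∉ P-y (≢-sym (leaf≢y a′-hangs)) y≢s)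
                       (leaf≢x b′-hangs) (leaf≢y b′-hangs) x≢y
      ... | yes _ | no b′∉ =
        ¬three-in-pair (squeezed b′-hangs P-b′ b′∉ P-a′ a′≢b′ a′≢s)
                       (squeezed b′-hangs P-b′ b′∉ P-x (≢-sym (leaf≢x b′-hangs)) x≢s)
                       (squeezed b′-hangs P-b′ b′∉ P-y (≢-sym (leaf≢y b′-hangs)) y≢s)
                       (leaf≢x a′-hangs) (leaf≢y a′-hangs) x≢y
      ... | yes a′∈ | yes b′∈ = not-¬ (clique P-x P-y x≢y (x∉ ∘ inj₁) (x∉ ∘ inj₂) (y∉ ∘ inj₁) (y∉ ∘ inj₂)) x≁y
        where
        x∉ : ¬ (x ≡ a ⊎ x ≡ b)
        x∉ x∈ = ¬three-in-pair a′∈ b′∈ x∈ a′≢b′ (leaf≢x a′-hangs) (leaf≢x b′-hangs)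
        y∉ : ¬ (y ≡ a ⊎ y ≡ b)
        y∉ y∈ = ¬three-in-pair a′∈ b′∈ y∈ a′≢b′ (leaf≢y a′-hangs) (leaf≢y b′-hangs)

gn″Shape-swap : ∀ {m} {G : Graph m} {s₁ a₁ b₁ s₂ a₂ b₂} →
                Gn″Shape G s₁ a₁ b₁ s₂ a₂ b₂ → Gn″Shape G s₂ a₂ b₂ s₁ a₁ b₁
gn″Shape-swap shape = record { s₁≢s₂ = ≢-sym s₁≢s₂ ; first = second ; second = first }
  where open Gn″Shape shape

module Gn″ShapeProperties {m : ℕ} {G : Graph m} (simple : IsSimple G) {s₁ a₁ b₁ s₂ a₂ b₂ : Fin m}
                          (shape : Gn″Shape G s₁ a₁ b₁ s₂ a₂ b₂) where
  open IsSimple simple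
  open Gn″Shape shape
  module F = PendantClique first
  module S = PendantClique second
  module F′ = PendantCliqueProperties simple first
  module S′ = PendantCliqueProperties simple second

  no-isolated : ∀ {u} → ¬ Isolated G u
  no-isolated {u} iso with u ≟ a₂ | u ≟ b₂
  ... | yes refl | _        = S′.isolated⇒∉ iso S.P-a
  ... | no _     | yes refl = S′.isolated⇒∉ iso S.P-b
  ... | no u≢a₂  | no u≢b₂  = F′.isolated⇒∉ iso (u≢a₂ , u≢b₂)

  touch : ∀ {x y ℓ} → G x y ≡ false → ℓ ≡ a₁ ⊎ ℓ ≡ b₁ → ℓ ≡ x ⊎ ℓ ≡ y → ¬ Threat (addEdge G x y) (_≢ s₂)
  touch {x} {y} x≁y ℓ∈ ℓ-end (isolated _ iso) = no-isolated (isolated-addEdge⁻ G x y iso)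
  touch {x} {y} {ℓ} x≁y ℓ∈ ℓ-end (pendantPair {s′} {a′} {b′} s′≢s₂ _ _ pp′) =
    not-¬ (endpoint ℓ-end) x≁y
    where
    open PendantPair pp′ renaming (a≢b to a≢b′; a-hangs to a-hangs′; b-hangs to b-hangs′)
    leaf∈₁ : ∀ {h} → Hangs (addEdge G x y) h s′ → h ≡ a₁ ⊎ h ≡ b₁
    leaf∈₁ h-hangs = decidable-stable (in-pair? a₁ b₁ _)
      λ h∉ → S′.leaf-outside (addEdge-⊇ G x y) h-hangs s′≢s₂ (h∉ ∘ inj₁ , h∉ ∘ inj₂)
    ℓ-hangs : Hangs (addEdge G x y) ℓ s′
    ℓ-hangs with ℓ ≟ a′ | ℓ ≟ b′
    ... | yes refl | _        = a-hangs′
    ... | no _     | yes refl = b-hangs′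
    ... | no ℓ≢a′  | no ℓ≢b′  = ⊥-elim (¬three-in-pair ℓ∈ (leaf∈₁ a-hangs′) (leaf∈₁ b-hangs′) ℓ≢a′ ℓ≢b′ a≢b′)
    ℓ~s₁ : G ℓ s₁ ≡ true
    ℓ~s₁ = [ (λ { refl → F.a~s }) , (λ { refl → F.b~s }) ] ℓ∈
    s₁≡s′ : s₁ ≡ s′
    s₁≡s′ = ℓ-hangs s₁ (addEdge-⊇ G x y ℓ~s₁)
    -- The other endpoint of the new edge must be the support s₁ of ℓ.
    endpoint : ℓ ≡ x ⊎ ℓ ≡ y → G x y ≡ true
    endpoint (inj₁ ℓ≡x) = subst₂ (λ u w → G u w ≡ true) ℓ≡x
      (trans s₁≡s′ (sym (ℓ-hangs y (subst (λ u → addEdge G x y u y ≡ true) (sym ℓ≡x) (addEdge-xy G x y))))) ℓ~s₁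
    endpoint (inj₂ ℓ≡y) = trans (symmetric x y) (subst₂ (λ u w → G u w ≡ true) ℓ≡y
      (trans s₁≡s′ (sym (ℓ-hangs x (subst (λ u → addEdge G x y u x ≡ true) (sym ℓ≡y) (addEdge-yx G x y))))) ℓ~s₁)

-- Criticality

module _ {m : ℕ} {G : Graph m} where

  isolated-and-pair⇒threats : ∀ {z s a b} → Isolated G z → PendantPair G s a b → s ≢ z → a ≢ z → b ≢ z →
                              ∀ d → Threat G (_≢ d)
  isolated-and-pair⇒threats {z} iso pp s≢z a≢z b≢z d with z ≟ d
  ... | yes refl = pendantPair s≢z a≢z b≢z pp
  ... | no  z≢d  = isolated z≢d iso

  two-pairs⇒threats : ∀ {s₁ a₁ b₁ s₂ a₂ b₂} → PendantPair G s₁ a₁ b₁ → PendantPair G s₂ a₂ b₂ →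
                      s₁ ≢ s₂ → s₁ ≢ a₂ × s₁ ≢ b₂ → a₁ ≢ a₂ × a₁ ≢ b₂ → b₁ ≢ a₂ × b₁ ≢ b₂ → s₂ ≢ a₁ × s₂ ≢ b₁ →
                      ∀ d → Threat G (_≢ d)
  two-pairs⇒threats {s₁} {a₁} {b₁} pp₁ pp₂ s₁≢s₂ (s₁≢a₂ , s₁≢b₂) (a₁≢a₂ , a₁≢b₂) (b₁≢a₂ , b₁≢b₂) (s₂≢a₁ , s₂≢b₁) d
    with d ≟ s₁ | d ≟ a₁ | d ≟ b₁
  ... | yes refl | _        | _        = pendantPair (≢-sym s₁≢s₂) (≢-sym s₁≢a₂) (≢-sym s₁≢b₂) pp₂
  ... | _        | yes refl | _        = pendantPair s₂≢a₁ (≢-sym a₁≢a₂) (≢-sym a₁≢b₂) pp₂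
  ... | _        | _        | yes refl = pendantPair s₂≢b₁ (≢-sym b₁≢a₂) (≢-sym b₁≢b₂) pp₂
  ... | no d≢s₁  | no d≢a₁  | no d≢b₁  = pendantPair (≢-sym d≢s₁) (≢-sym d≢a₁) (≢-sym d≢b₁) pp₁

module _ {m : ℕ} {G : Graph m} (simple : IsSimple G) where
  open GameProperties simple

  private
    stallerWinsS-2⇔⁺ : ∀ {x y} → x ≢ y → StallerWinsS (addEdge G x y) 2 ⇔ Threat (addEdge G x y) (λ _ → ⊤)
    stallerWinsS-2⇔⁺ x≢y = GameProperties.stallerWinsS-2⇔ (addEdge-simple G _ _ simple x≢y)

    stallerWinsD-2⇔⁺ : ∀ {x y} → x ≢ y →
                       StallerWinsD (addEdge G x y) 2 ⇔ (Fin m × ∀ d → Threat (addEdge G x y) (_≢ d))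
    stallerWinsD-2⇔⁺ x≢y = GameProperties.stallerWinsD-2⇔ (addEdge-simple G _ _ simple x≢y)

  gn′Shape⇒critical : ∀ {s a b} → Gn′Shape G s a b → Critical StallerWinsS 2 G
  gn′Shape⇒critical pc = Equivalence.from (critical-2⇔ StallerWinsS stallerWinsS-suc)
    ( Equivalence.from stallerWinsS-2⇔ (pendantPair tt tt tt pair)
    , (λ w₁ → isolated⇒∉ (proj₂ (Equivalence.to stallerWinsS-1⇔ w₁)) tt)
    , λ x y x≢y x≁y w → case Equivalence.to (stallerWinsS-2⇔⁺ x≢y) w of λ where
        (isolated _ iso)       → isolated⇒∉ (isolated-addEdge⁻ G x y iso) tt
        (pendantPair _ _ _ pp) → AfterEdge.no-pendantPair tt tt x≢y x≁y pp tt tt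
    )
    where
    open PendantClique pc
    open PendantCliqueProperties simple pc

  critical⇒gn′Shape : Critical StallerWinsS 2 G → ∃[ s ] ∃[ a ] ∃[ b ] Gn′Shape G s a b
  critical⇒gn′Shape crit with Equivalence.to (critical-2⇔ StallerWinsS stallerWinsS-suc) crit
  ... | w₂ , ¬w₁ , edges with Equivalence.to stallerWinsS-2⇔ w₂
  ...   | isolated _ iso = ⊥-elim (¬w₁ (Equivalence.from stallerWinsS-1⇔ (_ , iso)))
  ...   | pendantPair {s} {a} {b} _ _ _ pp = s , a , b , record
    { pair = pp ; P-s = tt ; P-a = tt ; P-b = tt
    ; a~s = hangs⇒adjacent G a-hangs (no-isolated a)
    ; b~s = hangs⇒adjacent G b-hangs (no-isolated b)
    ; clique = λ {x} {y} _ _ x≢y x≢a x≢b y≢a y≢b → ¬-not λ x≁y → edges x y x≢y x≁y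
        (Equivalence.from (stallerWinsS-2⇔⁺ x≢y)
          (pendantPair tt tt tt (pendantPair-addEdge G x y pp (≢-sym x≢a) (≢-sym y≢a) (≢-sym x≢b) (≢-sym y≢b))))
    }
    where
    open PendantPair pp
    no-isolated : ∀ u → ¬ Isolated G u
    no-isolated u iso = ¬w₁ (Equivalence.from stallerWinsS-1⇔ (u , iso))

  gn′∪K1Shape⇒critical : ∀ {z s a b} → Gn′∪K1Shape G z s a b → Critical StallerWinsD 2 G
  gn′∪K1Shape⇒critical {z} {s} shape = Equivalence.from (critical-2⇔ StallerWinsD stallerWinsD-suc)
    ( Equivalence.from stallerWinsD-2⇔ (z , isolated-and-pair⇒threats z-isolated pair P-s P-a P-b)
    , (λ w₁ → let (u , v , u≢v , iso-u , iso-v) = Equivalence.to stallerWinsD-1⇔ w₁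
              in u≢v (trans (isolated⇒z iso-u) (sym (isolated⇒z iso-v))))
    , edges
    )
    where
    open Gn′∪K1Shape shape
    open PendantClique rest
    open PendantCliqueProperties simple rest

    isolated⇒z : ∀ {u} → Isolated G u → u ≡ z
    isolated⇒z iso = decidable-stable (_ ≟ z) (isolated⇒∉ iso)

    z-touched : ∀ {x y} → ∃ (λ o → addEdge G x y z o ≡ true) → ¬ Threat (addEdge G x y) (_≢ s)
    z-touched {x} {y} (o , z~o) (isolated _ iso) with isolated⇒z (isolated-addEdge⁻ G x y iso)
    ... | refl = not-¬ z~o (iso o)
    z-touched {x} {y} _ (pendantPair s′≢s _ _ pp′) =
      a≢b′ (trans (leaf⇒z a-hangs′) (sym (leaf⇒z b-hangs′)))
      where
      open PendantPair pp′ renaming (a≢b to a≢b′; a-hangs to a-hangs′; b-hangs to b-hangs′)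
      leaf⇒z : ∀ {h} → Hangs (addEdge G x y) h _ → h ≡ z
      leaf⇒z h-hangs = decidable-stable (_ ≟ z) (leaf-outside (addEdge-⊇ G x y) h-hangs s′≢s)

    edges : ∀ x y → x ≢ y → G x y ≡ false → ¬ StallerWinsD (addEdge G x y) 2
    edges x y x≢y x≁y w with proj₂ (Equivalence.to (stallerWinsD-2⇔⁺ x≢y) w) | x ≟ z | y ≟ z
    ... | threats | yes refl | _        = z-touched (y , addEdge-xy G x y) (threats s)
    ... | threats | no _     | yes refl = z-touched (x , addEdge-yx G x y) (threats s)
    ... | threats | no x≢z   | no y≢z   = case threats z of λ where
      (isolated u≢z iso)             → isolated⇒∉ (isolated-addEdge⁻ G x y iso) u≢z
      (pendantPair _ a′≢z b′≢z pp′) → AfterEdge.no-pendantPair x≢z y≢z x≢y x≁y pp′ a′≢z b′≢z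

  gn″Shape⇒critical : ∀ {s₁ a₁ b₁ s₂ a₂ b₂} → Gn″Shape G s₁ a₁ b₁ s₂ a₂ b₂ → Critical StallerWinsD 2 G
  gn″Shape⇒critical {s₁} {a₁} {b₁} {s₂} {a₂} {b₂} shape =
    Equivalence.from (critical-2⇔ StallerWinsD stallerWinsD-suc)
    ( Equivalence.from stallerWinsD-2⇔ (s₁ , two-pairs⇒threats F.pair S.pair s₁≢s₂ F.P-s F.P-a F.P-b S.P-s)
    , (λ w₁ → let (_ , _ , _ , iso , _) = Equivalence.to stallerWinsD-1⇔ w₁ in no-isolated iso)
    , edges
    )
    where
    open Gn″Shape shape
    open Gn″ShapeProperties simple shape
    module Swapped = Gn″ShapeProperties simple (gn″Shape-swap shape)

    edges : ∀ x y → x ≢ y → G x y ≡ false → ¬ StallerWinsD (addEdge G x y) 2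
    edges x y x≢y x≁y w with proj₂ (Equivalence.to (stallerWinsD-2⇔⁺ x≢y) w)
    ... | threats with in-pair? a₁ b₁ x | in-pair? a₁ b₁ y | in-pair? a₂ b₂ x | in-pair? a₂ b₂ y
    ... | yes x∈₁ | _       | _       | _       = touch x≁y x∈₁ (inj₁ refl) (threats s₂)
    ... | no _    | yes y∈₁ | _       | _       = touch x≁y y∈₁ (inj₂ refl) (threats s₂)
    ... | no _    | no _    | yes x∈₂ | _       = Swapped.touch x≁y x∈₂ (inj₁ refl) (threats s₁)
    ... | no _    | no _    | no _    | yes y∈₂ = Swapped.touch x≁y y∈₂ (inj₂ refl) (threats s₁)
    ... | no x∉₁  | no y∉₁  | no x∉₂  | no y∉₂  = not-¬
      (F.clique (x∉₂ ∘ inj₁ , x∉₂ ∘ inj₂) (y∉₂ ∘ inj₁ , y∉₂ ∘ inj₂) x≢y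
                (x∉₁ ∘ inj₁) (x∉₁ ∘ inj₂) (y∉₁ ∘ inj₁) (y∉₁ ∘ inj₂))
      x≁y

  module CriticalD (crit : Critical StallerWinsD 2 G) where
    private
      facts = Equivalence.to (critical-2⇔ StallerWinsD stallerWinsD-suc) crit
      threat-system = Equivalence.to stallerWinsD-2⇔ (proj₁ facts)

    threats : ∀ d → Threat G (_≢ d)
    threats = proj₂ threat-system

    two-isolated : ∀ {u v} → Isolated G u → Isolated G v → u ≢ v → ⊥
    two-isolated iso-u iso-v u≢v =
      proj₁ (proj₂ facts) (Equivalence.from stallerWinsD-1⇔ (_ , _ , u≢v , iso-u , iso-v))

    edge-kills : ∀ {x y} → x ≢ y → G x y ≡ false → ¬ (∀ d → Threat (addEdge G x y) (_≢ d))
    edge-kills {x} {y} x≢y x≁y threats⁺ =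
      proj₂ (proj₂ facts) x y x≢y x≁y (Equivalence.from (stallerWinsD-2⇔⁺ x≢y) (proj₁ threat-system , threats⁺))

    gn′∪K1Shape : ∀ {z} → Isolated G z → ∃[ s ] ∃[ a ] ∃[ b ] Gn′∪K1Shape G z s a b
    gn′∪K1Shape {z} iso-z with threats z
    ... | isolated u≢z iso-u = ⊥-elim (two-isolated iso-u iso-z u≢z)
    ... | pendantPair {s} {a} {b} s≢z a≢z b≢z pp = s , a , b , record
      { z-isolated = iso-z
      ; rest = record
        { pair = pp ; P-s = s≢z ; P-a = a≢z ; P-b = b≢z
        ; a~s = hangs⇒adjacent G a-hangs (λ iso-a → two-isolated iso-a iso-z a≢z)
        ; b~s = hangs⇒adjacent G b-hangs (λ iso-b → two-isolated iso-b iso-z b≢z)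
        ; clique = λ {x} {y} x≢z y≢z x≢y x≢a x≢b y≢a y≢b → ¬-not λ x≁y → edge-kills x≢y x≁y
            (isolated-and-pair⇒threats (isolated-addEdge G x y iso-z (≢-sym x≢z) (≢-sym y≢z))
              (pendantPair-addEdge G x y pp (≢-sym x≢a) (≢-sym y≢a) (≢-sym x≢b) (≢-sym y≢b)) s≢z a≢z b≢z)
        }
      }
      where open PendantPair pp

    gn″Shape : (∀ u → ¬ Isolated G u) → ∃[ s₁ ] ∃[ a₁ ] ∃[ b₁ ] ∃[ s₂ ] ∃[ a₂ ] ∃[ b₂ ] Gn″Shape G s₁ a₁ b₁ s₂ a₂ b₂
    gn″Shape no-isolated with threats (proj₁ threat-system)
    ... | isolated _ iso = ⊥-elim (no-isolated _ iso)
    ... | pendantPair {s₁} {a₁} {b₁} _ _ _ pp₁ with threats s₁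
    ...   | isolated _ iso = ⊥-elim (no-isolated _ iso)
    ...   | pendantPair {s₂} {a₂} {b₂} s₂≢s₁ a₂≢s₁ b₂≢s₁ pp₂ = s₁ , a₁ , b₁ , s₂ , a₂ , b₂ , record
      { s₁≢s₂ = ≢-sym s₂≢s₁
      ; first = record
        { pair = pp₁ ; P-s = ≢-sym a₂≢s₁ , ≢-sym b₂≢s₁ ; P-a = a₁≢a₂ , a₁≢b₂ ; P-b = b₁≢a₂ , b₁≢b₂
        ; a~s = adjacent a₁-hangs ; b~s = adjacent b₁-hangs
        ; clique = λ (x≢a₂ , x≢b₂) (y≢a₂ , y≢b₂) x≢y x≢a₁ x≢b₁ y≢a₁ y≢b₁ →
            clique x≢y (x≢a₁ , x≢b₁ , x≢a₂ , x≢b₂) (y≢a₁ , y≢b₁ , y≢a₂ , y≢b₂)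
        }
      ; second = record
        { pair = pp₂ ; P-s = s₂≢a₁ , s₂≢b₁ ; P-a = ≢-sym a₁≢a₂ , ≢-sym b₁≢a₂ ; P-b = ≢-sym a₁≢b₂ , ≢-sym b₁≢b₂
        ; a~s = adjacent a₂-hangs ; b~s = adjacent b₂-hangs
        ; clique = λ (x≢a₁ , x≢b₁) (y≢a₁ , y≢b₁) x≢y x≢a₂ x≢b₂ y≢a₂ y≢b₂ →
            clique x≢y (x≢a₁ , x≢b₁ , x≢a₂ , x≢b₂) (y≢a₁ , y≢b₁ , y≢a₂ , y≢b₂)
        }
      }
      where
      open PendantPair pp₁ renaming (a-hangs to a₁-hangs; b-hangs to b₁-hangs)
      open PendantPair pp₂ renaming (a-hangs to a₂-hangs; b-hangs to b₂-hangs)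
      adjacent : ∀ {h s} → Hangs G h s → G h s ≡ true
      adjacent {h} hangs = hangs⇒adjacent G hangs (no-isolated h)
      apart = pendantPairs-apart simple pp₁ (adjacent a₂-hangs) (adjacent b₂-hangs) s₂≢s₁ a₂≢s₁
      a₁≢a₂ = proj₁ (proj₁ apart)
      a₁≢b₂ = proj₂ (proj₁ apart)
      b₁≢a₂ = proj₁ (proj₁ (proj₂ apart))
      b₁≢b₂ = proj₂ (proj₁ (proj₂ apart))
      s₂≢a₁ = proj₁ (proj₂ (proj₂ apart))
      s₂≢b₁ = proj₂ (proj₂ (proj₂ apart))
      NotLeaf : Fin m → Set
      NotLeaf v = v ≢ a₁ × v ≢ b₁ × v ≢ a₂ × v ≢ b₂
      clique : ∀ {x y} → x ≢ y → NotLeaf x → NotLeaf y → G x y ≡ true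
      clique {x} {y} x≢y (x≢a₁ , x≢b₁ , x≢a₂ , x≢b₂) (y≢a₁ , y≢b₁ , y≢a₂ , y≢b₂) = ¬-not λ x≁y → edge-kills x≢y x≁y
        (two-pairs⇒threats (pendantPair-addEdge G x y pp₁ (≢-sym x≢a₁) (≢-sym y≢a₁) (≢-sym x≢b₁) (≢-sym y≢b₁))
                           (pendantPair-addEdge G x y pp₂ (≢-sym x≢a₂) (≢-sym y≢a₂) (≢-sym x≢b₂) (≢-sym y≢b₂))
                           (≢-sym s₂≢s₁) (≢-sym a₂≢s₁ , ≢-sym b₂≢s₁) (a₁≢a₂ , a₁≢b₂) (b₁≢a₂ , b₁≢b₂) (s₂≢a₁ , s₂≢b₁))

    shape : (∃[ z ] ∃[ s ] ∃[ a ] ∃[ b ] Gn′∪K1Shape G z s a b) ⊎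
            (∃[ s₁ ] ∃[ a₁ ] ∃[ b₁ ] ∃[ s₂ ] ∃[ a₂ ] ∃[ b₂ ] Gn″Shape G s₁ a₁ b₁ s₂ a₂ b₂)
    shape with any? (λ u → all? (λ v → G u v Bool.≟ false))
    ... | yes (z , iso-z) = inj₁ (z , gn′∪K1Shape iso-z)
    ... | no  none        = inj₂ (gn″Shape (λ u iso → none (u , iso)))

module _ {m : ℕ} (G : Graph m) where

  record CliqueShape (Z : List (Fin m)) (L : List (Fin m × Fin m)) : Set where
    field
      Z-isolated : All (Isolated G) Z
      L-hangs    : All (λ (l , s) → Hangs G l s) L
      L-adjacent : All (λ (l , s) → G l s ≡ true) L
      clique     : ∀ {x y} → x ≢ y → x ∉ₗ Z → y ∉ₗ Z → x ∉ₗ map proj₁ L → y ∉ₗ map proj₁ L → G x y ≡ true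

module _ {m k : ℕ} {G : Graph m} {H : Graph k} (simple-G : IsSimple G) (simple-H : IsSimple H)
         (f : Fin m → Fin k) (f-inj : ∀ {a b} → f a ≡ f b → a ≡ b) {Z L}
         (shape-G : CliqueShape G Z L) (shape-H : CliqueShape H (map f Z) (map (Product.map f f) L)) where
  private
    module SG = CliqueShape shape-G
    module SH = CliqueShape shape-H

    Special : Fin m → Set
    Special x = x ∈ₗ Z ⊎ x ∈ₗ map proj₁ L

    special? : ∀ x → Dec (Special x)
    special? x = Any.any? (x ≟_) Z ⊎-dec Any.any? (x ≟_) (map proj₁ L)

    leaf-image : ∀ {x} → f x ∈ₗ map proj₁ (map (Product.map f f) L) → x ∈ₗ map proj₁ L
    leaf-image p = ∈-map-injective f-inj (subst (_ ∈ₗ_) (trans (sym (map-∘ L)) (map-∘ L)) p)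

    special-adjacency : ∀ {x} → Special x → ∀ y → G x y ≡ H (f x) (f y)
    special-adjacency (inj₁ x∈Z) y =
      trans (All.lookup SG.Z-isolated x∈Z y) (sym (All.lookup SH.Z-isolated (∈-map⁺ f x∈Z) (f y)))
    special-adjacency {x} (inj₂ x∈leaves) y with ∈-map⁻ proj₁ x∈leaves
    ... | (_ , s) , xs∈L , refl = ⇔→≡ {z = true} (mk⇔ to from)
      where
      xs∈L′ = ∈-map⁺ (Product.map f f) xs∈L
      to : G x y ≡ true → H (f x) (f y) ≡ true
      to e = subst (λ v → H (f x) (f v) ≡ true) (sym (All.lookup SG.L-hangs xs∈L y e))
                   (All.lookup SH.L-adjacent xs∈L′)
      from : H (f x) (f y) ≡ true → G x y ≡ true
      from e = subst (λ v → G x v ≡ true) (sym (f-inj (All.lookup SH.L-hangs xs∈L′ (f y) e)))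
                     (All.lookup SG.L-adjacent xs∈L)

  adjacency-preserved : ∀ x y → G x y ≡ H (f x) (f y)
  adjacency-preserved x y with special? x | special? y
  ... | yes x∈ | _      = special-adjacency x∈ y
  ... | no _   | yes y∈ = trans (IsSimple.symmetric simple-G x y)
                            (trans (special-adjacency y∈ x) (IsSimple.symmetric simple-H (f y) (f x)))
  ... | no x∉  | no y∉ with x ≟ y
  ...   | yes refl = trans (IsSimple.irreflexive simple-G x) (sym (IsSimple.irreflexive simple-H (f x)))
  ...   | no x≢y   = trans (SG.clique x≢y (x∉ ∘ inj₁) (y∉ ∘ inj₁) (x∉ ∘ inj₂) (y∉ ∘ inj₂))
                       (sym (SH.clique (x≢y ∘ f-inj)
                                       (x∉ ∘ inj₁ ∘ ∈-map-injective f-inj) (y∉ ∘ inj₁ ∘ ∈-map-injective f-inj)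
                                       (x∉ ∘ inj₂ ∘ leaf-image) (y∉ ∘ inj₂ ∘ leaf-image)))

cliqueShapes⇒≅ : ∀ {m} {G H : Graph m} → IsSimple G → IsSimple H → (π : Permutation m m) →
                 ∀ {Z L} → CliqueShape G Z L →
                 CliqueShape H (map (π ⟨$⟩ʳ_) Z) (map (Product.map (π ⟨$⟩ʳ_) (π ⟨$⟩ʳ_)) L) → G ≅ H
cliqueShapes⇒≅ simple-G simple-H π shape-G shape-H = record
  { bij      = π
  ; preserve = adjacency-preserved simple-G simple-H (π ⟨$⟩ʳ_) (permutation-injective π) shape-G shape-H
  }

module Transport {m k : ℕ} {G : Graph m} {H : Graph k} (iso : G ≅ H) where
  open _≅_ iso

  private
    f : Fin m → Fin k
    f = Inverse.to bij

    g : Fin k → Fin m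
    g = Inverse.from bij

    f∘g : ∀ u → f (g u) ≡ u
    f∘g u = Inverse.inverseˡ bij refl

    g∘f : ∀ v → g (f v) ≡ v
    g∘f v = Inverse.inverseʳ bij refl

    f-injective : ∀ {v w} → f v ≡ f w → v ≡ w
    f-injective {v} {w} e = trans (sym (g∘f v)) (trans (cong g e) (g∘f w))

    g-adjacency : ∀ u v → G (g u) v ≡ H u (f v)
    g-adjacency u v = trans (preserve (g u) v) (cong (λ w → H w (f v)) (f∘g u))

  ≢g⇔f≢ : ∀ {v u} → v ≢ g u ⇔ f v ≢ u
  ≢g⇔f≢ {v} {u} = mk⇔ (λ v≢gu fv≡u → v≢gu (trans (sym (g∘f v)) (cong g fv≡u)))
                      (λ fv≢u v≡gu → fv≢u (trans (cong f v≡gu) (f∘g u)))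

  g-≢ : ∀ {u w} → u ≢ w → g u ≢ g w
  g-≢ {u} {w} u≢w e = u≢w (trans (sym (f∘g u)) (trans (cong f e) (f∘g w)))

  isolated-transport : ∀ {u} → Isolated H u → Isolated G (g u)
  isolated-transport {u} iso-u v = trans (g-adjacency u v) (iso-u (f v))

  hangs-transport : ∀ {a s} → Hangs H a s → Hangs G (g a) (g s)
  hangs-transport {a} hangs v e = trans (sym (g∘f v)) (cong g (hangs (f v) (trans (sym (g-adjacency a v)) e)))

  pendantClique-transport : ∀ {P Q s a b} → (∀ {v} → Q v ⇔ P (f v)) →
                            PendantClique H P s a b → PendantClique G Q (g s) (g a) (g b)
  pendantClique-transport {P} {s = s} {a} {b} Q⇔P pc = record
    { pair = record
      { a≢b = g-≢ a≢b ; a≢s = g-≢ a≢s ; b≢s = g-≢ b≢s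
      ; a-hangs = hangs-transport a-hangs ; b-hangs = hangs-transport b-hangs
      }
    ; P-s = back P-s ; P-a = back P-a ; P-b = back P-b
    ; a~s = trans (g-adjacency a (g s)) (subst (λ w → H a w ≡ true) (sym (f∘g s)) a~s)
    ; b~s = trans (g-adjacency b (g s)) (subst (λ w → H b w ≡ true) (sym (f∘g s)) b~s)
    ; clique = λ Q-v Q-w v≢w v≢a v≢b w≢a w≢b → trans (preserve _ _)
        (clique (to Q⇔P Q-v) (to Q⇔P Q-w) (v≢w ∘ f-injective)
                (to ≢g⇔f≢ v≢a) (to ≢g⇔f≢ v≢b) (to ≢g⇔f≢ w≢a) (to ≢g⇔f≢ w≢b))
    }
    where
    open PendantClique pc
    open Equivalence using (to; from)
    back : ∀ {u} → P u → _
    back {u} P-u = from Q⇔P (subst P (sym (f∘g u)) P-u)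

-- The canonical graphs

clique-edge : ℕ → ℕ → ℕ → Bool
clique-edge n i j = ⌊ i ℕ.<? n ⌋ ∧ ⌊ j ℕ.<? n ⌋ ∧ not ⌊ i ℕ.≟ j ⌋

pendant-edge : ℕ × ℕ → ℕ → ℕ → Bool
pendant-edge (c , l) i j = (⌊ i ℕ.≟ c ⌋ ∧ ⌊ j ℕ.≟ l ⌋) ∨ (⌊ i ℕ.≟ l ⌋ ∧ ⌊ j ℕ.≟ c ⌋)

-- No trailing "∨ false", so that Gn' n, Gn'∪K1 n and Gn'' n are canonical graphs by definition.
pendant-edges : List (ℕ × ℕ) → ℕ → ℕ → Bool
pendant-edges []             i j = false
pendant-edges (p ∷ [])       i j = pendant-edge p i j
pendant-edges (p ∷ ps@(_ ∷ _)) i j = pendant-edge p i j ∨ pendant-edges ps i j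

-- The clique {0, …, n-1} with a leaf l attached to c for each pair (c , l) of ps.
canonical : ∀ {N} → ℕ → List (ℕ × ℕ) → Graph N
canonical n ps x y = clique-edge n (toℕ x) (toℕ y) ∨ pendant-edges ps (toℕ x) (toℕ y)

PendantEdge : ℕ × ℕ → ℕ → ℕ → Set
PendantEdge (c , l) i j = (i ≡ c × j ≡ l) ⊎ (i ≡ l × j ≡ c)

clique-edge⁻ : ∀ {n i j} → clique-edge n i j ≡ true → i < n × j < n × i ≢ j
clique-edge⁻ {n} {i} {j} e =
  let (i<n , rest) = ∧-true⁻ e ; (j<n , i≢j) = ∧-true⁻ rest
  in ⌊⌋-true⁻ (i ℕ.<? n) i<n , ⌊⌋-true⁻ (j ℕ.<? n) j<n , λ i≡j → not-¬ (⌊⌋-true⁺ (i ℕ.≟ j) i≡j) (not-injective i≢j)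

clique-edge⁺ : ∀ {n i j} → i < n → j < n → i ≢ j → clique-edge n i j ≡ true
clique-edge⁺ {n} {i} {j} i<n j<n i≢j =
  ∧-true⁺ (⌊⌋-true⁺ (i ℕ.<? n) i<n) (∧-true⁺ (⌊⌋-true⁺ (j ℕ.<? n) j<n) (cong not (⌊⌋-false⁺ (i ℕ.≟ j) i≢j)))

pendant-edge⁻ : ∀ p {i j} → pendant-edge p i j ≡ true → PendantEdge p i j
pendant-edge⁻ (c , l) {i} {j} e with ∨-true⁻ {⌊ i ℕ.≟ c ⌋ ∧ ⌊ j ℕ.≟ l ⌋} e
... | inj₁ e′ = let (i≡c , j≡l) = ∧-true⁻ e′ in inj₁ (⌊⌋-true⁻ (i ℕ.≟ c) i≡c , ⌊⌋-true⁻ (j ℕ.≟ l) j≡l)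
... | inj₂ e′ = let (i≡l , j≡c) = ∧-true⁻ e′ in inj₂ (⌊⌋-true⁻ (i ℕ.≟ l) i≡l , ⌊⌋-true⁻ (j ℕ.≟ c) j≡c)

pendant-edge⁺ : ∀ p {i j} → PendantEdge p i j → pendant-edge p i j ≡ true
pendant-edge⁺ (c , l) {i} {j} (inj₁ (i≡c , j≡l)) =
  ∨-trueˡ _ (∧-true⁺ (⌊⌋-true⁺ (i ℕ.≟ c) i≡c) (⌊⌋-true⁺ (j ℕ.≟ l) j≡l))
pendant-edge⁺ (c , l) {i} {j} (inj₂ (i≡l , j≡c)) =
  ∨-trueʳ (⌊ i ℕ.≟ c ⌋ ∧ ⌊ j ℕ.≟ l ⌋) (∧-true⁺ (⌊⌋-true⁺ (i ℕ.≟ l) i≡l) (⌊⌋-true⁺ (j ℕ.≟ c) j≡c))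

pendant-edges⁻ : ∀ ps {i j} → pendant-edges ps i j ≡ true → Any (λ p → PendantEdge p i j) ps
pendant-edges⁻ (p ∷ [])     e = here (pendant-edge⁻ p e)
pendant-edges⁻ (p ∷ ps@(_ ∷ _)) {i} {j} e =
  [ (λ e′ → here (pendant-edge⁻ p e′)) , (λ e′ → there (pendant-edges⁻ ps e′)) ] (∨-true⁻ {pendant-edge p i j} e)

pendant-edges⁺ : ∀ ps {i j} → Any (λ p → PendantEdge p i j) ps → pendant-edges ps i j ≡ true
pendant-edges⁺ (p ∷ [])     (here e)  = pendant-edge⁺ p e
pendant-edges⁺ (p ∷ _ ∷ _)  (here e)  = ∨-trueˡ _ (pendant-edge⁺ p e)
pendant-edges⁺ (p ∷ ps@(_ ∷ _)) {i} {j} (there a) = ∨-trueʳ (pendant-edge p i j) (pendant-edges⁺ ps a)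

record WellPlaced (n : ℕ) (ps : List (ℕ × ℕ)) : Set where
  field
    support<n : All (λ (c , l) → c < n) ps
    n≤leaf    : All (λ (c , l) → n ≤ l) ps
    leaves-distinct : AllPairs _≢_ (map proj₂ ps)

  functional : ∀ {c c′ l} → (c , l) ∈ₗ ps → (c′ , l) ∈ₗ ps → c ≡ c′
  functional = go leaves-distinct
    where
    go : ∀ {qs} → AllPairs _≢_ (map proj₂ qs) → ∀ {c c′ l} → (c , l) ∈ₗ qs → (c′ , l) ∈ₗ qs → c ≡ c′
    go _        (here refl) (here refl) = refl
    go (l∉ ∷ _) (here refl) (there q)   = contradiction refl (All.lookup l∉ (∈-map⁺ proj₂ q))
    go (l∉ ∷ _) (there p)   (here refl) = contradiction refl (All.lookup l∉ (∈-map⁺ proj₂ p))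
    go (_ ∷ d)  (there p)   (there q)   = go d p q

module Canonical {N n : ℕ} {ps : List (ℕ × ℕ)} (wp : WellPlaced n ps) where
  open WellPlaced wp

  private
    H : Graph N
    H = canonical n ps

    edge⁻ : ∀ {x y} → H x y ≡ true →
            (toℕ x < n × toℕ y < n × toℕ x ≢ toℕ y) ⊎ Any (λ p → PendantEdge p (toℕ x) (toℕ y)) ps
    edge⁻ {x} {y} e = Sum.map clique-edge⁻ (pendant-edges⁻ ps) (∨-true⁻ {clique-edge n (toℕ x) (toℕ y)} e)

    edge⁺ : ∀ {x y} → (toℕ x < n × toℕ y < n × toℕ x ≢ toℕ y) ⊎ Any (λ p → PendantEdge p (toℕ x) (toℕ y)) ps →
            H x y ≡ true
    edge⁺ (inj₁ (x<n , y<n , x≢y)) = ∨-trueˡ _ (clique-edge⁺ x<n y<n x≢y)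
    edge⁺ (inj₂ pe)                = ∨-trueʳ _ (pendant-edges⁺ ps pe)

    flip : ∀ {p i j} → PendantEdge p i j → PendantEdge p j i
    flip (inj₁ (i≡c , j≡l)) = inj₂ (j≡l , i≡c)
    flip (inj₂ (i≡l , j≡c)) = inj₁ (j≡c , i≡l)

    support≢leaf : ∀ {c l} → (c , l) ∈ₗ ps → ∀ {i} → i ≡ c → i ≢ l
    support≢leaf p refl refl = <⇒≱ (All.lookup support<n p) (All.lookup n≤leaf p)

  isSimple : IsSimple H
  isSimple = record
    { symmetric   = λ x y → ⇔→≡ {z = true} (mk⇔ flip-edge flip-edge)
    ; irreflexive = λ x → ¬-not (loop ∘ edge⁻)
    }
    where
    flip-edge : ∀ {x y} → H x y ≡ true → H y x ≡ true
    flip-edge = edge⁺ ∘ Sum.map (λ (x<n , y<n , x≢y) → y<n , x<n , ≢-sym x≢y) (Any.map flip) ∘ edge⁻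
    loop : ∀ {x} → ¬ ((toℕ x < n × toℕ x < n × toℕ x ≢ toℕ x) ⊎ Any (λ p → PendantEdge p (toℕ x) (toℕ x)) ps)
    loop (inj₁ (_ , _ , x≢x)) = x≢x refl
    loop (inj₂ pe) with find pe
    ... | _ , p∈ps , inj₁ (x≡c , x≡l) = support≢leaf p∈ps x≡c x≡l
    ... | _ , p∈ps , inj₂ (x≡l , x≡c) = support≢leaf p∈ps x≡c x≡l

  leaf-hangs : ∀ {c l a s} → (c , l) ∈ₗ ps → toℕ a ≡ l → toℕ s ≡ c → Hangs H a s
  leaf-hangs {c} {l} {a} {s} p a≡l s≡c v e with edge⁻ e
  ... | inj₁ (a<n , _) = contradiction (All.lookup n≤leaf p) (<⇒≱ (subst (_< n) a≡l a<n))
  ... | inj₂ pe with find pe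
  ...   | _ , q , inj₁ (a≡c′ , _) =
    contradiction (subst (n ≤_) (trans (sym a≡l) a≡c′) (All.lookup n≤leaf p)) (<⇒≱ (All.lookup support<n q))
  ...   | _ , q , inj₂ (a≡l′ , v≡c′) =
    toℕ-injective (trans v≡c′ (trans (sym (functional p (subst (λ l′ → (_ , l′) ∈ₗ ps) (trans (sym a≡l′) a≡l) q)))
                                     (sym s≡c)))

  leaf-adjacent : ∀ {c l a s} → (c , l) ∈ₗ ps → toℕ a ≡ l → toℕ s ≡ c → H a s ≡ true
  leaf-adjacent p a≡l s≡c = edge⁺ (inj₂ (Any.map (λ { refl → inj₂ (a≡l , s≡c) }) p))

  leaves-pendantPair : ∀ {c l l′ s a b} → (c , l) ∈ₗ ps → (c , l′) ∈ₗ ps → l ≢ l′ →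
                       toℕ s ≡ c → toℕ a ≡ l → toℕ b ≡ l′ → PendantPair H s a b
  leaves-pendantPair p p′ l≢l′ s≡c a≡l b≡l′ = record
    { a≢b     = toℕ-≢ a≡l b≡l′ l≢l′
    ; a≢s     = toℕ-≢ a≡l s≡c (≢-sym (support≢leaf p refl))
    ; b≢s     = toℕ-≢ b≡l′ s≡c (≢-sym (support≢leaf p′ refl))
    ; a-hangs = leaf-hangs p a≡l s≡c
    ; b-hangs = leaf-hangs p′ b≡l′ s≡c
    }

  clique : ∀ {x y} → toℕ x < n → toℕ y < n → x ≢ y → H x y ≡ true
  clique x<n y<n x≢y = edge⁺ (inj₁ (x<n , y<n , x≢y ∘ toℕ-injective))

  non-leaf-isolated : ∀ {u} → n ≤ toℕ u → (∀ {c} → (c , toℕ u) ∉ₗ ps) → Isolated H u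
  non-leaf-isolated n≤u not-leaf v = ¬-not λ e → case edge⁻ e of λ where
    (inj₁ (u<n , _)) → <⇒≱ u<n n≤u
    (inj₂ pe) → case find pe of λ where
      (_ , q , inj₁ (u≡c , _)) → <⇒≱ (All.lookup support<n q) (subst (n ≤_) u≡c n≤u)
      (_ , q , inj₂ (u≡l , _)) → not-leaf (subst (λ l → (_ , l) ∈ₗ ps) (sym u≡l) q)

+-≢ : ∀ n {i j} → i ≢ j → n + i ≢ n + j
+-≢ n i≢j = i≢j ∘ +-cancelˡ-≡ n _ _

n≢1+n : ∀ n → n ≢ suc n
n≢1+n n = <⇒≢ (n<1+n n)

n≢n+2+i : ∀ n i → n ≢ n + suc (suc i)
n≢n+2+i n i = <⇒≢ (m<m+n n z<s)

1+n≢n+2+i : ∀ n i → suc n ≢ n + suc (suc i)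
1+n≢n+2+i n i = subst (_≢ n + suc (suc i)) (+-comm n 1) (+-≢ n λ ())

-- The clique {0, …, n-1}, n = k + 1, with leaves n and n + 1 attached to 0, followed by t more vertices.
module Gn′Canonical (k t : ℕ) where
  n = suc k

  pendants : List (ℕ × ℕ)
  pendants = (0 , n) ∷ (0 , suc n) ∷ []

  wellPlaced : WellPlaced n pendants
  wellPlaced = record
    { support<n = z<s ∷ z<s ∷ []
    ; n≤leaf    = ≤-refl ∷ n≤1+n n ∷ []
    ; leaves-distinct = (n≢1+n n ∷ []) ∷ [] ∷ []
    }

  open Canonical {N = n + suc (suc t)} wellPlaced public using (isSimple; clique; non-leaf-isolated)
  open Canonical {N = n + suc (suc t)} wellPlaced using (leaves-pendantPair; leaf-adjacent)

  v₀ vA vB : Fin (n + suc (suc t))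
  v₀ = Fin.zero
  vA = n ↑ʳ Fin.zero
  vB = n ↑ʳ Fin.suc Fin.zero

  pair : PendantPair (canonical n pendants) v₀ vA vB
  pair = leaves-pendantPair (here refl) (there (here refl)) (n≢1+n n) refl (toℕ-↑ʳ₀ n) (toℕ-↑ʳ₁ n)

  vA~v₀ : canonical n pendants vA v₀ ≡ true
  vA~v₀ = leaf-adjacent (here refl) (toℕ-↑ʳ₀ n) refl

  vB~v₀ : canonical n pendants vB v₀ ≡ true
  vB~v₀ = leaf-adjacent (there (here refl)) (toℕ-↑ʳ₁ n) refl

  in-clique : ∀ {x} → x ≢ vA → x ≢ vB → toℕ x < n ⊎ ∃ λ i → x ≡ n ↑ʳ Fin.suc (Fin.suc i)
  in-clique {x} x≢vA x≢vB with ↑ˡ-or-↑ʳ n x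
  ... | inj₁ x<n                           = inj₁ x<n
  ... | inj₂ (Fin.zero , refl)               = contradiction refl x≢vA
  ... | inj₂ (Fin.suc Fin.zero , refl)      = contradiction refl x≢vB
  ... | inj₂ (Fin.suc (Fin.suc i) , x≡)     = inj₂ (i , x≡)

gn′Shape-canonical : ∀ k → let open Gn′Canonical k 0 in Gn′Shape (Gn' n) v₀ vA vB
gn′Shape-canonical k = record
  { pair = pair ; P-s = tt ; P-a = tt ; P-b = tt ; a~s = vA~v₀ ; b~s = vB~v₀
  ; clique = λ _ _ x≢y x≢a x≢b y≢a y≢b → clique (in-clique′ x≢a x≢b) (in-clique′ y≢a y≢b) x≢y
  }
  where
  open Gn′Canonical k 0
  in-clique′ : ∀ {x} → x ≢ vA → x ≢ vB → toℕ x < n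
  in-clique′ x≢vA x≢vB with in-clique x≢vA x≢vB
  ... | inj₁ x<n = x<n

gn′∪K1Shape-canonical : ∀ k → let open Gn′Canonical k 1 in Gn′∪K1Shape (Gn'∪K1 n) (n ↑ʳ (# 2)) v₀ vA vB
gn′∪K1Shape-canonical k = record
  { z-isolated = non-leaf-isolated (subst (n ≤_) (sym (toℕ-↑ʳ n (# 2))) (m≤m+n n 2)) λ where
      (here e)         → n≢n+2+i n 0 (trans (sym (cong proj₂ e)) (toℕ-↑ʳ n (# 2)))
      (there (here e)) → 1+n≢n+2+i n 0 (trans (sym (cong proj₂ e)) (toℕ-↑ʳ n (# 2)))
  ; rest = record
    { pair = pair
    ; P-s = toℕ-≢ refl (toℕ-↑ʳ n (# 2)) λ ()
    ; P-a = ↑ʳ-≢ n λ ()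
    ; P-b = ↑ʳ-≢ n λ ()
    ; a~s = vA~v₀ ; b~s = vB~v₀
    ; clique = λ x≢z y≢z x≢y x≢a x≢b y≢a y≢b → clique (in-clique′ x≢z x≢a x≢b) (in-clique′ y≢z y≢a y≢b) x≢y
    }
  }
  where
  open Gn′Canonical k 1
  in-clique′ : ∀ {x} → x ≢ n ↑ʳ (# 2) → x ≢ vA → x ≢ vB → toℕ x < n
  in-clique′ x≢vZ x≢vA x≢vB with in-clique x≢vA x≢vB
  ... | inj₁ x<n                  = x<n
  ... | inj₂ (Fin.zero , x≡vZ) = contradiction x≡vZ x≢vZ

module Gn″Canonical (k : ℕ) where
  n = suc (suc k)

  pendants : List (ℕ × ℕ)
  pendants = (0 , n) ∷ (0 , suc n) ∷ (1 , n + 2) ∷ (1 , n + 3) ∷ []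

  wellPlaced : WellPlaced n pendants
  wellPlaced = record
    { support<n = z<s ∷ z<s ∷ s<s z<s ∷ s<s z<s ∷ []
    ; n≤leaf    = ≤-refl ∷ n≤1+n n ∷ m≤m+n n 2 ∷ m≤m+n n 3 ∷ []
    ; leaves-distinct = (n≢1+n n ∷ n≢n+2+i n 0 ∷ n≢n+2+i n 1 ∷ [])
                      ∷ (1+n≢n+2+i n 0 ∷ 1+n≢n+2+i n 1 ∷ [])
                      ∷ (+-≢ n (λ ()) ∷ [])
                      ∷ [] ∷ []
    }

  open Canonical {N = n + 4} wellPlaced public using (isSimple)
  open Canonical {N = n + 4} wellPlaced

  v₀ v₁ vA₁ vB₁ vA₂ vB₂ : Fin (n + 4)
  v₀  = # 0
  v₁  = # 1
  vA₁ = n ↑ʳ # 0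
  vB₁ = n ↑ʳ # 1
  vA₂ = n ↑ʳ # 2
  vB₂ = n ↑ʳ # 3

  in-clique : ∀ {x} → x ≢ vA₁ → x ≢ vB₁ → x ≢ vA₂ → x ≢ vB₂ → toℕ x < n
  in-clique x≢vA₁ x≢vB₁ x≢vA₂ x≢vB₂ with ↑ˡ-or-↑ʳ n _
  ... | inj₁ x<n        = x<n
  ... | inj₂ (Fin.zero , refl)                            = contradiction refl x≢vA₁
  ... | inj₂ (Fin.suc Fin.zero , refl)                    = contradiction refl x≢vB₁
  ... | inj₂ (Fin.suc (Fin.suc Fin.zero) , refl)           = contradiction refl x≢vA₂
  ... | inj₂ (Fin.suc (Fin.suc (Fin.suc Fin.zero)) , refl) = contradiction refl x≢vB₂

  gn″Shape-canonical : Gn″Shape (Gn'' n) v₀ vA₁ vB₁ v₁ vA₂ vB₂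
  gn″Shape-canonical = record
    { s₁≢s₂ = λ ()
    ; first = record
      { pair = leaves-pendantPair (here refl) (there (here refl)) (n≢1+n n) refl (toℕ-↑ʳ₀ n) (toℕ-↑ʳ₁ n)
      ; P-s = toℕ-≢ refl (toℕ-↑ʳ n (# 2)) (λ ()) , toℕ-≢ refl (toℕ-↑ʳ n (# 3)) (λ ())
      ; P-a = ↑ʳ-≢ n (λ ()) , ↑ʳ-≢ n (λ ())
      ; P-b = ↑ʳ-≢ n (λ ()) , ↑ʳ-≢ n (λ ())
      ; a~s = leaf-adjacent (here refl) (toℕ-↑ʳ₀ n) refl
      ; b~s = leaf-adjacent (there (here refl)) (toℕ-↑ʳ₁ n) refl
      ; clique = λ (x≢a₂ , x≢b₂) (y≢a₂ , y≢b₂) x≢y x≢a₁ x≢b₁ y≢a₁ y≢b₁ →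
          clique (in-clique x≢a₁ x≢b₁ x≢a₂ x≢b₂) (in-clique y≢a₁ y≢b₁ y≢a₂ y≢b₂) x≢y
      }
    ; second = record
      { pair = leaves-pendantPair (there (there (here refl))) (there (there (there (here refl)))) (+-≢ n λ ())
                                  refl (toℕ-↑ʳ n (# 2)) (toℕ-↑ʳ n (# 3))
      ; P-s = toℕ-≢ refl (toℕ-↑ʳ₀ n) (λ ()) , toℕ-≢ refl (toℕ-↑ʳ₁ n) (λ ())
      ; P-a = ↑ʳ-≢ n (λ ()) , ↑ʳ-≢ n (λ ())
      ; P-b = ↑ʳ-≢ n (λ ()) , ↑ʳ-≢ n (λ ())
      ; a~s = leaf-adjacent (there (there (here refl))) (toℕ-↑ʳ n (# 2)) refl
      ; b~s = leaf-adjacent (there (there (there (here refl)))) (toℕ-↑ʳ n (# 3)) refl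
      ; clique = λ (x≢a₁ , x≢b₁) (y≢a₁ , y≢b₁) x≢y x≢a₂ x≢b₂ y≢a₂ y≢b₂ →
          clique (in-clique x≢a₁ x≢b₁ x≢a₂ x≢b₂) (in-clique y≢a₁ y≢b₁ y≢a₂ y≢b₂) x≢y
      }
    }

-- Shapes versus isomorphisms

module _ {m : ℕ} {G : Graph m} where

  gn′Shape-distinct : ∀ {s a b} → Gn′Shape G s a b → AllPairs _≢_ (s ∷ a ∷ b ∷ [])
  gn′Shape-distinct pc = (≢-sym a≢s ∷ ≢-sym b≢s ∷ []) ∷ (a≢b ∷ []) ∷ [] ∷ []
    where open PendantClique pc

  gn′∪K1Shape-distinct : ∀ {z s a b} → Gn′∪K1Shape G z s a b → AllPairs _≢_ (z ∷ s ∷ a ∷ b ∷ [])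
  gn′∪K1Shape-distinct shape =
    (≢-sym P-s ∷ ≢-sym P-a ∷ ≢-sym P-b ∷ []) ∷ (≢-sym a≢s ∷ ≢-sym b≢s ∷ []) ∷ (a≢b ∷ []) ∷ [] ∷ []
    where
    open Gn′∪K1Shape shape
    open PendantClique rest

  gn″Shape-distinct : ∀ {s₁ a₁ b₁ s₂ a₂ b₂} → Gn″Shape G s₁ a₁ b₁ s₂ a₂ b₂ →
                      AllPairs _≢_ (s₁ ∷ s₂ ∷ a₁ ∷ b₁ ∷ a₂ ∷ b₂ ∷ [])
  gn″Shape-distinct shape =
      (s₁≢s₂ ∷ ≢-sym F.a≢s ∷ ≢-sym F.b≢s ∷ proj₁ F.P-s ∷ proj₂ F.P-s ∷ [])
    ∷ (proj₁ S.P-s ∷ proj₂ S.P-s ∷ ≢-sym S.a≢s ∷ ≢-sym S.b≢s ∷ [])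
    ∷ (F.a≢b ∷ proj₁ F.P-a ∷ proj₂ F.P-a ∷ [])
    ∷ (proj₁ F.P-b ∷ proj₂ F.P-b ∷ [])
    ∷ (S.a≢b ∷ [])
    ∷ [] ∷ []
    where
    open Gn″Shape shape
    module F = PendantClique first
    module S = PendantClique second

  gn′Shape⇒cliqueShape : ∀ {s a b} → Gn′Shape G s a b → CliqueShape G [] ((a , s) ∷ (b , s) ∷ [])
  gn′Shape⇒cliqueShape pc = record
    { Z-isolated = []
    ; L-hangs    = a-hangs ∷ b-hangs ∷ []
    ; L-adjacent = a~s ∷ b~s ∷ []
    ; clique     = λ x≢y _ _ x∉ y∉ → clique tt tt x≢y (x∉ ∘ here) (x∉ ∘ there ∘ here) (y∉ ∘ here) (y∉ ∘ there ∘ here)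
    }
    where open PendantClique pc

  gn′∪K1Shape⇒cliqueShape : ∀ {z s a b} → Gn′∪K1Shape G z s a b → CliqueShape G (z ∷ []) ((a , s) ∷ (b , s) ∷ [])
  gn′∪K1Shape⇒cliqueShape shape = record
    { Z-isolated = z-isolated ∷ []
    ; L-hangs    = a-hangs ∷ b-hangs ∷ []
    ; L-adjacent = a~s ∷ b~s ∷ []
    ; clique     = λ x≢y x∉Z y∉Z x∉ y∉ →
        clique (x∉Z ∘ here) (y∉Z ∘ here) x≢y (x∉ ∘ here) (x∉ ∘ there ∘ here) (y∉ ∘ here) (y∉ ∘ there ∘ here)
    }
    where
    open Gn′∪K1Shape shape
    open PendantClique rest

  gn″Shape⇒cliqueShape : ∀ {s₁ a₁ b₁ s₂ a₂ b₂} → Gn″Shape G s₁ a₁ b₁ s₂ a₂ b₂ →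
                         CliqueShape G [] ((a₁ , s₁) ∷ (b₁ , s₁) ∷ (a₂ , s₂) ∷ (b₂ , s₂) ∷ [])
  gn″Shape⇒cliqueShape shape = record
    { Z-isolated = []
    ; L-hangs    = F.a-hangs ∷ F.b-hangs ∷ S.a-hangs ∷ S.b-hangs ∷ []
    ; L-adjacent = F.a~s ∷ F.b~s ∷ S.a~s ∷ S.b~s ∷ []
    ; clique     = λ x≢y _ _ x∉ y∉ →
        F.clique (x∉ ∘ there ∘ there ∘ here , x∉ ∘ there ∘ there ∘ there ∘ here)
                 (y∉ ∘ there ∘ there ∘ here , y∉ ∘ there ∘ there ∘ there ∘ here)
                 x≢y (x∉ ∘ here) (x∉ ∘ there ∘ here) (y∉ ∘ here) (y∉ ∘ there ∘ here)
    }
    where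
    open Gn″Shape shape
    module F = PendantClique first
    module S = PendantClique second

module _ {m : ℕ} {G : Graph m} (simple : IsSimple G) where

  gn′Shape⇒≅ : ∀ {s a b} → Gn′Shape G s a b → Σ ℕ λ n → 1 ≤ n × G ≅ Gn' n
  gn′Shape⇒≅ {s} {a} {b} shape with size-split 1 2 (distinct⇒length≤ (gn′Shape-distinct shape))
  ... | suc k , s≤s z≤n , refl = suc k , s≤s z≤n , build
    (extend-to-permutation (zip (s ∷ a ∷ b ∷ []) (v₀ ∷ vA ∷ vB ∷ []))
                           (gn′Shape-distinct shape) (gn′Shape-distinct (gn′Shape-canonical k)))
    where
    open Gn′Canonical k 0
    build : (∃ λ π → All (λ (x , y) → π ⟨$⟩ʳ x ≡ y) (zip (s ∷ a ∷ b ∷ []) (v₀ ∷ vA ∷ vB ∷ []))) → G ≅ Gn' n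
    build (π , π-s ∷ π-a ∷ π-b ∷ []) = cliqueShapes⇒≅ simple isSimple π
      (gn′Shape⇒cliqueShape shape)
      (subst (λ (s′ , a′ , b′) → CliqueShape (Gn' n) [] ((a′ , s′) ∷ (b′ , s′) ∷ []))
             (sym (cong₂ _,_ π-s (cong₂ _,_ π-a π-b)))
             (gn′Shape⇒cliqueShape (gn′Shape-canonical k)))

  gn′∪K1Shape⇒≅ : ∀ {z s a b} → Gn′∪K1Shape G z s a b → Σ ℕ λ n → 1 ≤ n × G ≅ Gn'∪K1 n
  gn′∪K1Shape⇒≅ {z} {s} {a} {b} shape with size-split 1 3 (distinct⇒length≤ (gn′∪K1Shape-distinct shape))
  ... | suc k , s≤s z≤n , refl = suc k , s≤s z≤n , build
    (extend-to-permutation (zip (z ∷ s ∷ a ∷ b ∷ []) ((n ↑ʳ # 2) ∷ v₀ ∷ vA ∷ vB ∷ []))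
                           (gn′∪K1Shape-distinct shape) (gn′∪K1Shape-distinct (gn′∪K1Shape-canonical k)))
    where
    open Gn′Canonical k 1
    build : (∃ λ π → All (λ (x , y) → π ⟨$⟩ʳ x ≡ y) (zip (z ∷ s ∷ a ∷ b ∷ []) ((n ↑ʳ # 2) ∷ v₀ ∷ vA ∷ vB ∷ []))) →
            G ≅ Gn'∪K1 n
    build (π , π-z ∷ π-s ∷ π-a ∷ π-b ∷ []) = cliqueShapes⇒≅ simple isSimple π
      (gn′∪K1Shape⇒cliqueShape shape)
      (subst (λ (z′ , s′ , a′ , b′) → CliqueShape (Gn'∪K1 n) (z′ ∷ []) ((a′ , s′) ∷ (b′ , s′) ∷ []))
             (sym (cong₂ _,_ π-z (cong₂ _,_ π-s (cong₂ _,_ π-a π-b))))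
             (gn′∪K1Shape⇒cliqueShape (gn′∪K1Shape-canonical k)))

  gn″Shape⇒≅ : ∀ {s₁ a₁ b₁ s₂ a₂ b₂} → Gn″Shape G s₁ a₁ b₁ s₂ a₂ b₂ → Σ ℕ λ n → 2 ≤ n × G ≅ Gn'' n
  gn″Shape⇒≅ {s₁} {a₁} {b₁} {s₂} {a₂} {b₂} shape with size-split 2 4 (distinct⇒length≤ (gn″Shape-distinct shape))
  ... | suc (suc k) , s≤s (s≤s z≤n) , refl = suc (suc k) , s≤s (s≤s z≤n) , build
    (extend-to-permutation (zip (s₁ ∷ s₂ ∷ a₁ ∷ b₁ ∷ a₂ ∷ b₂ ∷ []) (v₀ ∷ v₁ ∷ vA₁ ∷ vB₁ ∷ vA₂ ∷ vB₂ ∷ []))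
                           (gn″Shape-distinct shape) (gn″Shape-distinct gn″Shape-canonical))
    where
    open Gn″Canonical k
    build : (∃ λ π → All (λ (x , y) → π ⟨$⟩ʳ x ≡ y)
                          (zip (s₁ ∷ s₂ ∷ a₁ ∷ b₁ ∷ a₂ ∷ b₂ ∷ []) (v₀ ∷ v₁ ∷ vA₁ ∷ vB₁ ∷ vA₂ ∷ vB₂ ∷ []))) →
            G ≅ Gn'' n
    build (π , π-s₁ ∷ π-s₂ ∷ π-a₁ ∷ π-b₁ ∷ π-a₂ ∷ π-b₂ ∷ []) = cliqueShapes⇒≅ simple isSimple π
      (gn″Shape⇒cliqueShape shape)
      (subst (λ (s₁′ , a₁′ , b₁′ , s₂′ , a₂′ , b₂′) →
                CliqueShape (Gn'' n) [] ((a₁′ , s₁′) ∷ (b₁′ , s₁′) ∷ (a₂′ , s₂′) ∷ (b₂′ , s₂′) ∷ []))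
             (sym (cong₂ _,_ π-s₁ (cong₂ _,_ π-a₁ (cong₂ _,_ π-b₁ (cong₂ _,_ π-s₂ (cong₂ _,_ π-a₂ π-b₂))))))
             (gn″Shape⇒cliqueShape gn″Shape-canonical))

module _ {m : ℕ} {G : Graph m} (simple : IsSimple G) where

  gn′Shape⇔≅Gn′ : (∃[ s ] ∃[ a ] ∃[ b ] Gn′Shape G s a b) ⇔ (Σ ℕ λ n → 1 ≤ n × G ≅ Gn' n)
  gn′Shape⇔≅Gn′ = mk⇔ (λ (_ , _ , _ , shape) → gn′Shape⇒≅ simple shape) λ where
    (suc k , s≤s z≤n , iso) → _ , _ , _ , Transport.pendantClique-transport iso (mk⇔ _ _) (gn′Shape-canonical k)

  gn′∪K1Shape⇔≅Gn′∪K1 : (∃[ z ] ∃[ s ] ∃[ a ] ∃[ b ] Gn′∪K1Shape G z s a b) ⇔ (Σ ℕ λ n → 1 ≤ n × G ≅ Gn'∪K1 n)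
  gn′∪K1Shape⇔≅Gn′∪K1 = mk⇔ (λ (_ , _ , _ , _ , shape) → gn′∪K1Shape⇒≅ simple shape) from
    where
    from : (Σ ℕ λ n → 1 ≤ n × G ≅ Gn'∪K1 n) → ∃[ z ] ∃[ s ] ∃[ a ] ∃[ b ] Gn′∪K1Shape G z s a b
    from (suc k , s≤s z≤n , iso) = _ , _ , _ , _ , record
      { z-isolated = isolated-transport z-isolated
      ; rest       = pendantClique-transport ≢g⇔f≢ rest
      }
      where
      open Transport iso
      open Gn′∪K1Shape (gn′∪K1Shape-canonical k)

  gn″Shape⇔≅Gn″ : (∃[ s₁ ] ∃[ a₁ ] ∃[ b₁ ] ∃[ s₂ ] ∃[ a₂ ] ∃[ b₂ ] Gn″Shape G s₁ a₁ b₁ s₂ a₂ b₂) ⇔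
                  (Σ ℕ λ n → 2 ≤ n × G ≅ Gn'' n)
  gn″Shape⇔≅Gn″ = mk⇔ (λ (_ , _ , _ , _ , _ , _ , shape) → gn″Shape⇒≅ simple shape) from
    where
    from : (Σ ℕ λ n → 2 ≤ n × G ≅ Gn'' n) →
           ∃[ s₁ ] ∃[ a₁ ] ∃[ b₁ ] ∃[ s₂ ] ∃[ a₂ ] ∃[ b₂ ] Gn″Shape G s₁ a₁ b₁ s₂ a₂ b₂
    from (suc (suc k) , s≤s (s≤s z≤n) , iso) = _ , _ , _ , _ , _ , _ , record
      { s₁≢s₂  = g-≢ s₁≢s₂
      ; first  = pendantClique-transport (≢g⇔f≢ ×-⇔ ≢g⇔f≢) first
      ; second = pendantClique-transport (≢g⇔f≢ ×-⇔ ≢g⇔f≢) second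
      }
      where
      open Transport iso
      open Gn″Shape (Gn″Canonical.gn″Shape-canonical k)

  criticalS⇔gn′Shape : Critical StallerWinsS 2 G ⇔ (∃[ s ] ∃[ a ] ∃[ b ] Gn′Shape G s a b)
  criticalS⇔gn′Shape = mk⇔ (critical⇒gn′Shape simple) (λ (_ , _ , _ , shape) → gn′Shape⇒critical simple shape)

  criticalD⇔shapes : Critical StallerWinsD 2 G ⇔
                     ((∃[ z ] ∃[ s ] ∃[ a ] ∃[ b ] Gn′∪K1Shape G z s a b) ⊎
                      (∃[ s₁ ] ∃[ a₁ ] ∃[ b₁ ] ∃[ s₂ ] ∃[ a₂ ] ∃[ b₂ ] Gn″Shape G s₁ a₁ b₁ s₂ a₂ b₂))
  criticalD⇔shapes = mk⇔ (λ crit → CriticalD.shape simple crit)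
    [ (λ (_ , _ , _ , _ , shape) → gn′∪K1Shape⇒critical simple shape)
    , (λ (_ , _ , _ , _ , _ , _ , shape) → gn″Shape⇒critical simple shape)
    ]

theorem5p3 : (∀ {m} (G : Graph m) → IsSimple G →
               (Critical StallerWinsD 2 G ⇔
                 ((Σ ℕ λ n → 1 ≤ n × G ≅ Gn'∪K1 n) ⊎ (Σ ℕ λ n → 2 ≤ n × G ≅ Gn'' n))))
             × (∀ {m} (G : Graph m) → IsSimple G →
               (Critical StallerWinsS 2 G ⇔ (Σ ℕ λ n → 1 ≤ n × G ≅ Gn' n)))
theorem5p3 =
    (λ G simple → (gn′∪K1Shape⇔≅Gn′∪K1 simple ⊎-⇔ gn″Shape⇔≅Gn″ simple) ⇔-∘ criticalD⇔shapes simple)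
  , (λ G simple → gn′Shape⇔≅Gn′ simple ⇔-∘ criticalS⇔gn′Shape simple)
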